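{- Let $n\ge2$ and let $\mathsf r=[r_1,\dots,r_{2n-2}]$ be a tree-like factorization of $\lambda_n$. For each $j=1,\dots,2n-2$, the reflection $(r_1\cdots r_{j-1})\,r_j\,(r_{j-1}\cdots r_1)$ can be written as $(\!(0,m_j)\!)$ for an integer $m_j$. Then $\mathsf r$ is cyclic if and only if $m_1<m_2<\cdots<m_{2n-2}$.
   Context: $\widetilde S_n$ is the affine symmetric group: bijections $w:\mathbb Z\to\mathbb Z$ with $w(i+n)=w(i)+n$ and $\sum_{i=1}^n w(i)=\binom{n+1}{2}$, multiplied by composition $(vw)(k)=v(w(k))$. For $i\not\equiv j\pmod n$ the affine reflection $(\!(i,j)\!)$ interchanges $i+kn$ and $j+kn$ for all $k\in\mathbb Z$ and fixes other integers. $\lambda_n(k)=k+n$ if $k\not\equiv0\pmod n$ and $\lambda_n(k)=k-n(n-1)$ if $k\equiv 0\pmod n$; its reflection length is $2n-2$. A tree-like factorization of $\lambda_n$ is a sequence $\mathsf r=[r_1,\dots,r_{2n-2}]$ of affine reflections with $r_1\cdots r_{2n-2}=\lambda_n$ for which there are integers $a_0,\dots,a_{2n-3},b_1,\dots,b_{2n-2}$ with $r_k=(\!(a_{k-1},b_k)\!)$, $a_{k-1}<b_k$ ($1\le k\le 2n-2$) and $a_k\equiv b_k\pmod n$ ($1\le k\le 2n-3$). For $k\in[n]$ let $\mathrm{nb}_k(\mathsf r)$ be the sequence, in increasing order of $i$, of the residues of $b_i$ modulo $n$ (taken in $\{1,\dots,n\}$) over those $i$ with $a_{i-1}\equiv k\pmod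 n$. The tree-like factorization is cyclic if (i) $\mathrm{nb}_n(\mathsf r)$ is strictly increasing, and (ii) for every $1\le k<n$, writing $\mathrm{nb}_k(\mathsf r)=[c_1,\dots,c_\ell]$, there is $1\le j\le\ell$ with $c_j<c_{j+1}<\dots<c_{\ell-1}<k<c_1<\dots<c_{j-1}$. -}

module Defs where

open import Data.Nat as ℕ using (ℕ; zero; suc; _∸_; NonZero)
open import Data.Integer as ℤ using (ℤ; +_; _-_; _+_; _%ℕ_)
open import Data.Integer.Divisibility.Signed using (_∣_; _∣?_)
open import Data.List using (List; []; _∷_; map; filter; take; drop; length; _++_; upTo)
open import Data.List.Relation.Unary.Linked using (Linked)
open import Data.Product using (Σ; ∃; _×_; _,_)
open import Relation.Nullary using (¬_; yes; no)
open import Relation.Binary.PropositionalEquality using (_≡_)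
open import Function using (id; _∘_)

_≡[_]_ : ℤ → ℕ → ℤ → Set
x ≡[ n ] y = (+ n) ∣ (x - y)

-- The affine reflection ((i,j)) of Ŝ_n, as a function ℤ → ℤ:
-- it interchanges i + kn and j + kn for all k and fixes every other integer.
-- (Only meaningful when i ≢ j mod n; this is always assumed where it is used.)
refl⟨_⟩ : ℕ → ℤ → ℤ → ℤ → ℤ
refl⟨ n ⟩ i j x with (+ n) ∣? (x - i)
... | yes _ = (x - i) + j
... | no _ with (+ n) ∣? (x - j)
...   | yes _ = (x - j) + i
...   | no _  = x

lam : ℕ → ℤ → ℤ
lam n x with (+ n) ∣? x
... | yes _ = x - (+ (n ℕ.* (n ∸ 1)))
... | no _  = x + (+ n)

-- For a sequence of maps r : ℕ → (ℤ → ℤ) (r m = r_m):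
-- lprod r m = r_1 ∘ r_2 ∘ ⋯ ∘ r_m   (the product r_1 ⋯ r_m, with (vw)(k) = v(w(k)))
lprod : (ℕ → ℤ → ℤ) → ℕ → ℤ → ℤ
lprod r zero    = id
lprod r (suc m) = lprod r m ∘ r (suc m)

rprod : (ℕ → ℤ → ℤ) → ℕ → ℤ → ℤ
rprod r zero    = id
rprod r (suc m) = r (suc m) ∘ rprod r m

-- The reflections r_k = ((a_{k-1}, b_k)) of a tree-like factorization given
-- by its integer data a, b (indices outside the relevant range are ignored).
reflSeq : ℕ → (ℕ → ℤ) → (ℕ → ℤ) → ℕ → ℤ → ℤ
reflSeq n a b k = refl⟨ n ⟩ (a (k ∸ 1)) (b k)

record TreeLike (n : ℕ) (a b : ℕ → ℤ) : Set where
  field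
    lt      : ∀ k → 1 ℕ.≤ k → k ℕ.≤ 2 ℕ.* n ∸ 2 → a (k ∸ 1) ℤ.< b k
    cong    : ∀ k → 1 ℕ.≤ k → k ℕ.≤ 2 ℕ.* n ∸ 3 → a k ≡[ n ] b k
    isRefl  : ∀ k → 1 ℕ.≤ k → k ℕ.≤ 2 ℕ.* n ∸ 2 → ¬ (a (k ∸ 1) ≡[ n ] b k)
    product : ∀ x → lprod (reflSeq n a b) (2 ℕ.* n ∸ 2) x ≡ lam n x

res : (n : ℕ) .{{_ : NonZero n}} → ℤ → ℕ
res n x with x %ℕ n
... | zero  = n
... | suc r = suc r

oneTo : ℕ → List ℕ
oneTo N = map suc (upTo N)

nb : (n : ℕ) .{{_ : NonZero n}} → (ℕ → ℤ) → (ℕ → ℤ) → ℕ → List ℕ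
nb n a b k = map (λ i → res n (b i))
                 (filter (λ i → (+ n) ∣? (a (i ∸ 1) - + k)) (oneTo (2 ℕ.* n ∸ 2)))

StrictInc : List ℕ → Set
StrictInc = Linked ℕ._<_

-- Condition (ii) for cs = [c_1, …, c_ℓ]: there is 1 ≤ j ≤ ℓ such that
-- c_j < c_{j+1} < ⋯ < c_{ℓ-1} < k < c_1 < ⋯ < c_{j-1}.
CycCond : ℕ → List ℕ → Set
CycCond k cs = ∃ λ j → 1 ℕ.≤ j × j ℕ.≤ length cs ×
  StrictInc (drop (j ∸ 1) (take (length cs ∸ 1) cs) ++ (k ∷ take (j ∸ 1) cs))

Cyclic : (n : ℕ) .{{_ : NonZero n}} → (ℕ → ℤ) → (ℕ → ℤ) → Set
Cyclic n a b = StrictInc (nb n a b n)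
             × (∀ k → 1 ℕ.≤ k → k ℕ.< n → CycCond k (nb n a b k))

{-# OPTIONS --safe #-}
-- Steps are indexed from 0: step k is r (k + 1) = ((a k , b (k + 1))), of length d k > 0.  Let p
-- be the partial sums of d starting from a 0.  Then p k ≡ a k and p (k + 1) ≡ b (k + 1) (mod n),
-- so r (k + 1) = ((p k , p (k + 1))) and r 1 ⋯ r k sends p k to p 0; conjugating r (k + 1) by
-- r 1 ⋯ r k thus gives ((p 0 , r 1 ⋯ r k (p (k + 1)))) = ((0 , m)), as λ_n sending p N > p 0 to
-- p 0 forces p 0 ≡ 0.
--
-- For the order of the m's, follow each residue c ∈ {1, …, n - 1} (a token) through r 1, r 2, …:
-- it moves down by d k exactly at the steps k whose m is ≡ c, and ends at λ_n⁻¹ c = c - n.  It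
-- cannot move never or only once, so, as there are 2 (n - 1) steps, it moves at exactly two
-- steps f < g, with d f + d g = n, m = p (f + 1) - p 0 at f and m = p (g + 1) + d f - p 0 at g.
-- Hence m increases iff d f < d (g + 1) whenever step g + 1 is the first move of its token,
-- i.e. iff for every residue class the lengths of consecutive steps leaving it increase, except at
-- the last one for a non-zero class.  Since b (k + 1) ≡ a k + d k, this is what the cyclic
-- condition on the residues nb says.

module Submission where

open import Defs
open import Data.Nat as ℕ using (ℕ; zero; suc; _∸_; _≤_; _<_; _≟_; NonZero; z≤n; s≤s)
import Data.Nat.Properties as ℕ
import Data.Nat.Divisibility as ℕ
open import Data.Integer as ℤ using (ℤ; +_; _+_; _-_; _*_; -_; +<+; _%ℕ_; _/ℕ_)
import Data.Integer.Properties as ℤ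
open import Data.Integer.DivMod using (a≡a%ℕn+[a/ℕn]*n; n%ℕd<d)
open import Data.Integer.Divisibility.Signed using (_∣_; _∣?_; divides; ∣⇒∣ᵤ; ∣m⇒∣-m; ∣m∣n⇒∣m+n)
open import Data.Integer.Tactic.RingSolver using (solve-∀)
open import Data.Bool using (if_then_else_)
open import Data.Empty using (⊥; ⊥-elim)
open import Data.Product using (∃; _×_; _,_; proj₁; proj₂)
open import Data.Sum using (_⊎_; inj₁; inj₂; [_,_]′)
open import Data.List using (List; []; _∷_; map; filter; take; drop; length; _++_; applyUpTo)
open import Data.List.Properties using (length-map; length-take; map-∘; map-applyUpTo; take-map; take-take; take++drop≡id)
open import Data.List.Membership.Propositional using (_∈_)
open import Data.List.Relation.Unary.All as All using (All; []; _∷_)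
import Data.List.Relation.Unary.All.Properties as All
open import Data.List.Relation.Unary.Any using (here; there)
open import Data.List.Relation.Unary.Linked as Linked using (Linked; []; [-]; _∷_)
import Data.List.Relation.Unary.Linked.Properties as Linked
open import Function using (_∘_; id; _⇔_; mk⇔; Equivalence)
open import Function.Properties.Equivalence using () renaming (trans to ⇔-trans)
open import Level using (0ℓ)
open import Relation.Nullary using (¬_; Dec; yes; no; does)
open import Relation.Nullary.Decidable using (dec-true; dec-false)
open import Relation.Unary using (Decidable)
open import Relation.Binary.Bundles using (Setoid)
open import Relation.Binary.Structures using (IsEquivalence)
open import Relation.Binary.Definitions using (Tri; tri<; tri≈; tri>)
import Relation.Binary.Reasoning.Setoid as SetoidReasoning
open import Relation.Binary.PropositionalEquality
  using (_≡_; _≢_; refl; sym; trans; cong; cong₂; subst; subst₂; module ≡-Reasoning)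
open import Algebra.Properties.CommutativeSemigroup ℕ.+-commutativeSemigroup using (interchange)

-- Counting in a range

InRange : ℕ → ℕ → ℕ → Set
InRange lo M j = lo ≤ j × j < lo ℕ.+ M

InRange-empty : ∀ {lo j} → ¬ InRange lo 0 j
InRange-empty {lo} {j} (lo≤j , j<lo+0) = ℕ.<⇒≱ j<lo+0 (subst (_≤ j) (sym (ℕ.+-identityʳ lo)) lo≤j)

InRange-lo : ∀ {lo M} → InRange lo (suc M) lo
InRange-lo {lo} = ℕ.≤-refl , ℕ.m<m+n lo (s≤s z≤n)

InRange-suc : ∀ {lo M j} → InRange (suc lo) M j → InRange lo (suc M) j
InRange-suc {lo} {M} {j} (lo<j , j<) = ℕ.<⇒≤ lo<j , subst (j <_) (sym (ℕ.+-suc lo M)) j<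

InRange-split : ∀ {lo M j} → InRange lo (suc M) j → j ≡ lo ⊎ InRange (suc lo) M j
InRange-split {lo} {M} {j} (lo≤j , j<) with j ≟ lo
... | yes j≡lo = inj₁ j≡lo
... | no j≢lo  = inj₂ (ℕ.≤∧≢⇒< lo≤j (j≢lo ∘ sym) , subst (j <_) (ℕ.+-suc lo M) j<)

sumRange : (ℕ → ℕ) → ℕ → ℕ → ℕ
sumRange f lo zero    = 0
sumRange f lo (suc M) = f lo ℕ.+ sumRange f (suc lo) M

sumRange-+ : ∀ f g lo M →
             sumRange (λ i → f i ℕ.+ g i) lo M ≡ sumRange f lo M ℕ.+ sumRange g lo M
sumRange-+ f g lo zero    = refl
sumRange-+ f g lo (suc M) = begin
  f lo ℕ.+ g lo ℕ.+ sumRange (λ i → f i ℕ.+ g i) (suc lo) M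
    ≡⟨ cong (f lo ℕ.+ g lo ℕ.+_) (sumRange-+ f g (suc lo) M) ⟩
  f lo ℕ.+ g lo ℕ.+ (sumRange f (suc lo) M ℕ.+ sumRange g (suc lo) M)
    ≡⟨ interchange (f lo) (g lo) _ _ ⟩
  f lo ℕ.+ sumRange f (suc lo) M ℕ.+ (g lo ℕ.+ sumRange g (suc lo) M) ∎
  where open ≡-Reasoning

sumRange-≥ : ∀ {k} f lo M → (∀ c → InRange lo M c → k ≤ f c) → M ℕ.* k ≤ sumRange f lo M
sumRange-≥ f lo zero    k≤f = z≤n
sumRange-≥ f lo (suc M) k≤f =
  ℕ.+-mono-≤ (k≤f lo InRange-lo) (sumRange-≥ f (suc lo) M (λ c → k≤f c ∘ InRange-suc))

sumRange-tight-head : ∀ {k} f lo M → (∀ c → InRange lo (suc M) c → k ≤ f c) →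
                      sumRange f lo (suc M) ≡ suc M ℕ.* k →
                      f lo ≡ k × sumRange f (suc lo) M ≡ M ℕ.* k
sumRange-tight-head {k} f lo M k≤f sum≡ = f-lo≡k , rest≡
  where
  k≤rest : M ℕ.* k ≤ sumRange f (suc lo) M
  k≤rest = sumRange-≥ f (suc lo) M (λ c → k≤f c ∘ InRange-suc)
  f-lo≡k : f lo ≡ k
  f-lo≡k = ℕ.≤-antisym
    (ℕ.+-cancelʳ-≤ _ _ _ (ℕ.≤-trans (ℕ.≤-reflexive sum≡) (ℕ.+-monoʳ-≤ k k≤rest)))
    (k≤f lo InRange-lo)
  rest≡ : sumRange f (suc lo) M ≡ M ℕ.* k
  rest≡ = ℕ.+-cancelˡ-≡ k _ _ (trans (cong (ℕ._+ sumRange f (suc lo) M) (sym f-lo≡k)) sum≡)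

sumRange-tight : ∀ {k} f lo M → (∀ c → InRange lo M c → k ≤ f c) →
                 sumRange f lo M ≡ M ℕ.* k → ∀ c → InRange lo M c → f c ≡ k
sumRange-tight f lo zero k≤f _ c c∈ = ⊥-elim (InRange-empty c∈)
sumRange-tight f lo (suc M) k≤f sum≡ c c∈ with InRange-split c∈
... | inj₁ refl = proj₁ (sumRange-tight-head f lo M k≤f sum≡)
... | inj₂ c∈′  = sumRange-tight f (suc lo) M (λ c → k≤f c ∘ InRange-suc)
                    (proj₂ (sumRange-tight-head f lo M k≤f sum≡)) c c∈′

δ : ℕ → ℕ → ℕ
δ x y = if does (x ≟ y) then 1 else 0

δ-refl : ∀ x → δ x x ≡ 1
δ-refl x rewrite dec-true (x ≟ x) refl = refl

δ-≢ : ∀ {x y} → x ≢ y → δ x y ≡ 0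
δ-≢ {x} {y} x≢y rewrite dec-false (x ≟ y) x≢y = refl

sumRange-δ-below : ∀ t lo M → t < lo → sumRange (δ t) lo M ≡ 0
sumRange-δ-below t lo zero    t<lo = refl
sumRange-δ-below t lo (suc M) t<lo = begin
  δ t lo ℕ.+ sumRange (δ t) (suc lo) M ≡⟨ cong₂ ℕ._+_ (δ-≢ (ℕ.<⇒≢ t<lo)) (sumRange-δ-below t (suc lo) M (ℕ.m<n⇒m<1+n t<lo)) ⟩
  0                                  ∎
  where open ≡-Reasoning

sumRange-δ : ∀ t lo M → InRange lo M t → sumRange (δ t) lo M ≡ 1
sumRange-δ t lo zero    t∈ = ⊥-elim (InRange-empty t∈)
sumRange-δ t lo (suc M) t∈ with InRange-split t∈
... | inj₁ refl = cong₂ ℕ._+_ (δ-refl t) (sumRange-δ-below t (suc t) M (ℕ.n<1+n t))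
... | inj₂ t∈′  = cong₂ ℕ._+_ (δ-≢ (ℕ.<⇒≢ (proj₁ t∈′) ∘ sym)) (sumRange-δ t (suc lo) M t∈′)

sumRange-0 : ∀ lo M → sumRange (λ _ → 0) lo M ≡ 0
sumRange-0 lo zero    = refl
sumRange-0 lo (suc M) = sumRange-0 (suc lo) M

count : (ℕ → ℕ) → ℕ → ℕ → ℕ → ℕ
count t c = sumRange (λ j → δ (t j) c)

sumRange-count : ∀ t jl JM cl CM → (∀ j → InRange jl JM j → InRange cl CM (t j)) →
                 sumRange (λ c → count t c jl JM) cl CM ≡ JM
sumRange-count t jl zero    cl CM _    = sumRange-0 cl CM
sumRange-count t jl (suc JM) cl CM t∈ = begin
  sumRange (λ c → δ (t jl) c ℕ.+ count t c (suc jl) JM) cl CM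
    ≡⟨ sumRange-+ (δ (t jl)) (λ c → count t c (suc jl) JM) cl CM ⟩
  sumRange (δ (t jl)) cl CM ℕ.+ sumRange (λ c → count t c (suc jl) JM) cl CM
    ≡⟨ cong₂ ℕ._+_ (sumRange-δ (t jl) cl CM (t∈ jl InRange-lo))
                 (sumRange-count t (suc jl) JM cl CM (λ j → t∈ j ∘ InRange-suc)) ⟩
  suc JM ∎
  where open ≡-Reasoning

count-hit : ∀ t {c} lo M → t lo ≡ c → count t c lo (suc M) ≡ suc (count t c (suc lo) M)
count-hit t lo M refl = cong (ℕ._+ count t (t lo) (suc lo) M) (δ-refl (t lo))

count-miss : ∀ t {c} lo M → t lo ≢ c → count t c lo (suc M) ≡ count t c (suc lo) M
count-miss t {c} lo M t-lo≢c = cong (ℕ._+ count t c (suc lo) M) (δ-≢ t-lo≢c)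

count≡0 : ∀ t c lo M → count t c lo M ≡ 0 → ∀ j → InRange lo M j → t j ≢ c
count≡0 t c lo zero    _   j j∈ = ⊥-elim (InRange-empty j∈)
count≡0 t c lo (suc M) cnt j j∈ with t lo ≟ c | InRange-split j∈
... | yes t-lo≡c | _         = ⊥-elim (ℕ.1+n≢0 (trans (sym (count-hit t lo M t-lo≡c)) cnt))
... | no t-lo≢c  | inj₁ refl = t-lo≢c
... | no t-lo≢c  | inj₂ j∈′  = count≡0 t c (suc lo) M (trans (sym (count-miss t lo M t-lo≢c)) cnt) j j∈′

record UniqueOccurrence (t : ℕ → ℕ) (c lo M : ℕ) : Set where
  field
    pos   : ℕ
    pos∈  : InRange lo M pos
    t-pos : t pos ≡ c
    only  : ∀ j → InRange lo M j → t j ≡ c → j ≡ pos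

record TwoOccurrences (t : ℕ → ℕ) (c lo M : ℕ) : Set where
  field
    first second : ℕ
    first∈       : InRange lo M first
    second∈      : InRange lo M second
    first<second : first < second
    t-first      : t first ≡ c
    t-second     : t second ≡ c
    only         : ∀ j → InRange lo M j → t j ≡ c → j ≡ first ⊎ j ≡ second

count≡1 : ∀ t c lo M → count t c lo M ≡ 1 → UniqueOccurrence t c lo M
count≡1 t c lo zero ()
count≡1 t c lo (suc M) cnt with t lo ≟ c
... | yes t-lo≡c = record { pos = lo ; pos∈ = InRange-lo ; t-pos = t-lo≡c ; only = only }
  where
  none : count t c (suc lo) M ≡ 0
  none = ℕ.suc-injective (trans (sym (count-hit t lo M t-lo≡c)) cnt)
  only : ∀ j → InRange lo (suc M) j → t j ≡ c → j ≡ lo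
  only j j∈ t-j≡c with InRange-split j∈
  ... | inj₁ j≡lo = j≡lo
  ... | inj₂ j∈′  = ⊥-elim (count≡0 t c (suc lo) M none j j∈′ t-j≡c)
... | no t-lo≢c = record { pos = pos ; pos∈ = InRange-suc pos∈ ; t-pos = t-pos ; only = only′ }
  where
  open UniqueOccurrence (count≡1 t c (suc lo) M (trans (sym (count-miss t lo M t-lo≢c)) cnt))
  only′ : ∀ j → InRange lo (suc M) j → t j ≡ c → j ≡ pos
  only′ j j∈ t-j≡c with InRange-split j∈
  ... | inj₁ refl = ⊥-elim (t-lo≢c t-j≡c)
  ... | inj₂ j∈′  = only j j∈′ t-j≡c

count≡2 : ∀ t c lo M → count t c lo M ≡ 2 → TwoOccurrences t c lo M
count≡2 t c lo zero ()
count≡2 t c lo (suc M) cnt with t lo ≟ c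
... | yes t-lo≡c = record
  { first = lo ; second = pos ; first∈ = InRange-lo ; second∈ = InRange-suc pos∈
  ; first<second = proj₁ pos∈ ; t-first = t-lo≡c ; t-second = t-pos ; only = only′ }
  where
  open UniqueOccurrence (count≡1 t c (suc lo) M (ℕ.suc-injective (trans (sym (count-hit t lo M t-lo≡c)) cnt)))
  only′ : ∀ j → InRange lo (suc M) j → t j ≡ c → j ≡ lo ⊎ j ≡ pos
  only′ j j∈ t-j≡c with InRange-split j∈
  ... | inj₁ j≡lo = inj₁ j≡lo
  ... | inj₂ j∈′  = inj₂ (only j j∈′ t-j≡c)
... | no t-lo≢c = record
  { first = first ; second = second ; first∈ = InRange-suc first∈ ; second∈ = InRange-suc second∈
  ; first<second = first<second ; t-first = t-first ; t-second = t-second ; only = only′ }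
  where
  open TwoOccurrences (count≡2 t c (suc lo) M (trans (sym (count-miss t lo M t-lo≢c)) cnt))
  only′ : ∀ j → InRange lo (suc M) j → t j ≡ c → j ≡ first ⊎ j ≡ second
  only′ j j∈ t-j≡c with InRange-split j∈
  ... | inj₁ refl = ⊥-elim (t-lo≢c t-j≡c)
  ... | inj₂ j∈′  = only j j∈′ t-j≡c

-- Consecutive elements of a filtered range

range : ℕ → ℕ → List ℕ
range lo zero    = []
range lo (suc M) = lo ∷ range (suc lo) M

applyUpTo≡range : ∀ {f} lo M → (∀ i → f i ≡ lo ℕ.+ i) → applyUpTo f M ≡ range lo M
applyUpTo≡range lo zero    f≗ = refl
applyUpTo≡range lo (suc M) f≗ = cong₂ _∷_ (trans (f≗ 0) (ℕ.+-identityʳ lo))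
  (applyUpTo≡range (suc lo) M (λ i → trans (f≗ (suc i)) (ℕ.+-suc lo i)))

oneTo≡range : ∀ M → oneTo M ≡ range 1 M
oneTo≡range M = trans (map-applyUpTo id suc M) (applyUpTo≡range 1 M (λ _ → refl))

filter-range-suc : ∀ {P : ℕ → Set} (P? : Decidable P) lo M →
                   filter P? (range (suc lo) M) ≡ map suc (filter (P? ∘ suc) (range lo M))
filter-range-suc P? lo zero    = refl
filter-range-suc P? lo (suc M) with P? (suc lo)
... | yes _ = cong (suc lo ∷_) (filter-range-suc P? (suc lo) M)
... | no _  = filter-range-suc P? (suc lo) M

dropLast : {A : Set} → List A → List A
dropLast xs = take (length xs ∸ 1) xs

dropLast-map : ∀ {A B : Set} (f : A → B) xs → dropLast (map f xs) ≡ map f (dropLast xs)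
dropLast-map f xs = trans (cong (λ l → take (l ∸ 1) (map f xs)) (length-map f xs)) (take-map (length xs ∸ 1) xs)

length-dropLast : ∀ {A : Set} (xs : List A) → length (dropLast xs) ≡ length xs ∸ 1
length-dropLast xs = trans (length-take (length xs ∸ 1) xs) (ℕ.m≤n⇒m⊓n≡m (ℕ.m∸n≤m (length xs) 1))

take-dropLast : ∀ {A : Set} t (xs : List A) → t ≤ length xs ∸ 1 → take t (dropLast xs) ≡ take t xs
take-dropLast t xs t≤ = trans (take-take t (length xs ∸ 1) xs) (cong (λ m → take m xs) (ℕ.m≤n⇒m⊓n≡m t≤))

record Consecutive (P : ℕ → Set) (lo M i i′ : ℕ) : Set where
  constructor consecutive
  field
    left∈   : InRange lo M i
    right∈  : InRange lo M i′
    left<right : i < i′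
    P-left  : P i
    P-right : P i′
    gap     : ∀ k → i < k → k < i′ → ¬ P k

HasLater : (P : ℕ → Set) (lo M i : ℕ) → Set
HasLater P lo M i = ∃ λ j → InRange lo M j × i < j × P j

module _ {P : ℕ → Set} {lo M : ℕ} where

  Consecutive-grow : ∀ {i i′} → Consecutive P (suc lo) M i i′ → Consecutive P lo (suc M) i i′
  Consecutive-grow (consecutive i∈ i′∈ i<i′ P-i P-i′ gap) =
    consecutive (InRange-suc i∈) (InRange-suc i′∈) i<i′ P-i P-i′ gap

  Consecutive-shrink : ∀ {i i′} → Consecutive P lo (suc M) i i′ → i ≢ lo → Consecutive P (suc lo) M i i′
  Consecutive-shrink (consecutive i∈ i′∈ i<i′ P-i P-i′ gap) i≢lo with InRange-split i∈ | InRange-split i′∈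
  ... | inj₁ i≡lo | _          = ⊥-elim (i≢lo i≡lo)
  ... | inj₂ (lo<i , _) | inj₁ refl = ⊥-elim (ℕ.<-asym lo<i i<i′)
  ... | inj₂ i∈′  | inj₂ i′∈′  = consecutive i∈′ i′∈′ i<i′ P-i P-i′ gap

  Consecutive-lo≤right : ∀ {i i′} → Consecutive P lo M i i′ → lo ≤ i′
  Consecutive-lo≤right c = ℕ.<⇒≤ (ℕ.≤-<-trans (proj₁ (Consecutive.left∈ c)) (Consecutive.left<right c))

  Consecutive-right∈ : ∀ {i i′} → Consecutive P lo (suc M) i i′ → InRange (suc lo) M i′
  Consecutive-right∈ (consecutive (lo≤i , _) i′∈ i<i′ _ _ _) with InRange-split i′∈
  ... | inj₁ refl = ⊥-elim (ℕ.<⇒≱ i<i′ lo≤i)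
  ... | inj₂ i′∈′ = i′∈′

  HasLater-grow : ∀ {i} → HasLater P (suc lo) M i → HasLater P lo (suc M) i
  HasLater-grow (j , j∈ , i<j , P-j) = j , InRange-suc j∈ , i<j , P-j

  HasLater-shrink : ∀ {i} → lo ≤ i → HasLater P lo (suc M) i → HasLater P (suc lo) M i
  HasLater-shrink lo≤i (j , j∈ , i<j , P-j) with InRange-split j∈
  ... | inj₁ refl = ⊥-elim (ℕ.<⇒≱ i<j lo≤i)
  ... | inj₂ j∈′  = j , j∈′ , i<j , P-j

module _ {P : ℕ → Set} (P? : Decidable P) where

  filterRange : ℕ → ℕ → List ℕ
  filterRange lo M = filter P? (range lo M)

  filterRange-all : ∀ lo M → All (λ i → InRange lo M i × P i) (filterRange lo M)
  filterRange-all lo zero = []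
  filterRange-all lo (suc M) with P? lo
  ... | yes P-lo = (InRange-lo , P-lo) ∷ All.map (λ (i∈ , P-i) → InRange-suc i∈ , P-i) (filterRange-all (suc lo) M)
  ... | no _     = All.map (λ (i∈ , P-i) → InRange-suc i∈ , P-i) (filterRange-all (suc lo) M)

  filterRange-∈ : ∀ lo M {x} → InRange lo M x → P x → x ∈ filterRange lo M
  filterRange-∈ lo zero    x∈ _ = ⊥-elim (InRange-empty x∈)
  filterRange-∈ lo (suc M) x∈ P-x with P? lo | InRange-split x∈
  ... | yes _    | inj₁ refl = here refl
  ... | yes _    | inj₂ x∈′  = there (filterRange-∈ (suc lo) M x∈′ P-x)
  ... | no ¬P-lo | inj₁ refl = ⊥-elim (¬P-lo P-x)
  ... | no _     | inj₂ x∈′  = filterRange-∈ (suc lo) M x∈′ P-x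

  filterRange-[] : ∀ lo M → filterRange lo M ≡ [] → ∀ x → InRange lo M x → ¬ P x
  filterRange-[] lo M eq x x∈ P-x with filterRange lo M | filterRange-∈ lo M x∈ P-x
  filterRange-[] lo M refl x x∈ P-x | [] | ()

  filterRange-head : ∀ lo M {x xs} → filterRange lo M ≡ x ∷ xs →
                     InRange lo M x × P x × (∀ k → lo ≤ k → k < x → ¬ P k)
  filterRange-head lo zero ()
  filterRange-head lo (suc M) eq with P? lo
  filterRange-head lo (suc M) refl | yes P-lo = InRange-lo , P-lo , λ k lo≤k k<lo → ⊥-elim (ℕ.<⇒≱ k<lo lo≤k)
  filterRange-head lo (suc M) eq   | no ¬P-lo with filterRange-head (suc lo) M eq
  ... | x∈ , P-x , before = InRange-suc x∈ , P-x , before′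
    where
    before′ : ∀ k → lo ≤ k → k < _ → ¬ P k
    before′ k lo≤k k<x with k ≟ lo
    ... | yes refl = ¬P-lo
    ... | no k≢lo  = before k (ℕ.≤∧≢⇒< lo≤k (k≢lo ∘ sym)) k<x

  filterRange-increasing : ∀ lo M {x xs} → filterRange lo M ≡ x ∷ xs → All (x <_) xs
  filterRange-increasing lo zero ()
  filterRange-increasing lo (suc M) eq with P? lo
  filterRange-increasing lo (suc M) refl | yes _ = All.map (proj₁ ∘ proj₁) (filterRange-all (suc lo) M)
  filterRange-increasing lo (suc M) eq   | no _  = filterRange-increasing (suc lo) M eq

  Consecutive-from-head : ∀ {lo M y ys} → P lo → filterRange (suc lo) M ≡ y ∷ ys →
                          Consecutive P lo (suc M) lo y
  Consecutive-from-head {lo} {M} P-lo eq with filterRange-head (suc lo) M eq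
  ... | y∈ , P-y , before = consecutive InRange-lo (InRange-suc y∈) (proj₁ y∈) P-lo P-y before

  Consecutive-to-head : ∀ {lo M i′ y ys} → Consecutive P lo (suc M) lo i′ →
                        filterRange (suc lo) M ≡ y ∷ ys → i′ ≡ y
  Consecutive-to-head {lo} {M} {i′} {y} (consecutive _ _ lo<i′ _ P-i′ gap) eq
    with filterRange-head (suc lo) M eq | ℕ.<-cmp i′ y
  ... | _                   | tri≈ _ i′≡y _ = i′≡y
  ... | _ , _ , before      | tri< i′<y _ _ = ⊥-elim (before i′ lo<i′ i′<y P-i′)
  ... | (lo<y , _) , P-y , _ | tri> _ _ y<i′ = ⊥-elim (gap y lo<y y<i′ P-y)

  Linked-filterRange⁻ : ∀ {R : ℕ → ℕ → Set} lo M → Linked R (filterRange lo M) →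
                        ∀ {i i′} → Consecutive P lo M i i′ → R i i′
  Linked-filterRange⁻ lo zero _ c = ⊥-elim (InRange-empty (Consecutive.left∈ c))
  Linked-filterRange⁻ {R = R} lo (suc M) linked {i} c with P? lo
  ... | no ¬P-lo = Linked-filterRange⁻ (suc lo) M linked
                     (Consecutive-shrink c (λ { refl → ¬P-lo (Consecutive.P-left c) }))
  ... | yes P-lo with i ≟ lo
  ...   | no i≢lo = Linked-filterRange⁻ (suc lo) M (Linked.tail linked) (Consecutive-shrink c i≢lo)
  ...   | yes refl with filterRange (suc lo) M in eq
  ...     | []    = ⊥-elim (filterRange-[] (suc lo) M eq _ (Consecutive-right∈ c) (Consecutive.P-right c))
  ...     | y ∷ _ = subst (R lo) (sym (Consecutive-to-head c eq)) (Linked.head linked)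

  Linked-filterRange⁺ : ∀ {R : ℕ → ℕ → Set} lo M → (∀ {i i′} → Consecutive P lo M i i′ → R i i′) →
                        Linked R (filterRange lo M)
  Linked-filterRange⁺ lo zero    R-cons = []
  Linked-filterRange⁺ lo (suc M) R-cons with P? lo
  ... | no _     = Linked-filterRange⁺ (suc lo) M (R-cons ∘ Consecutive-grow)
  ... | yes P-lo with filterRange (suc lo) M in eq | Linked-filterRange⁺ (suc lo) M (R-cons ∘ Consecutive-grow)
  ...   | []    | _      = [-]
  ...   | y ∷ _ | linked = R-cons (Consecutive-from-head P-lo eq) ∷ linked

  HasLater⇒nonempty-tail : ∀ lo M {y ys} → filterRange lo M ≡ y ∷ ys → HasLater P lo M y → ys ≢ []
  HasLater⇒nonempty-tail lo M eq (j , j∈ , y<j , P-j) refl with subst (j ∈_) eq (filterRange-∈ lo M j∈ P-j)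
  ... | here refl = ℕ.<-irrefl refl y<j

  Linked-dropLast-filterRange⁻ : ∀ {R : ℕ → ℕ → Set} lo M → Linked R (dropLast (filterRange lo M)) →
                                 ∀ {i i′} → Consecutive P lo M i i′ → HasLater P lo M i′ → R i i′
  Linked-dropLast-filterRange⁻ lo zero _ c _ = ⊥-elim (InRange-empty (Consecutive.left∈ c))
  Linked-dropLast-filterRange⁻ lo (suc M) linked {i} {i′} c later with P? lo
  ... | no ¬P-lo = Linked-dropLast-filterRange⁻ (suc lo) M linked
                     (Consecutive-shrink c (λ { refl → ¬P-lo (Consecutive.P-left c) }))
                     (HasLater-shrink (Consecutive-lo≤right c) later)
  ... | yes P-lo with filterRange (suc lo) M in eq
  ...   | [] = ⊥-elim (filterRange-[] (suc lo) M eq i′ (Consecutive-right∈ c) (Consecutive.P-right c))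
  ...   | y ∷ ys with i ≟ lo
  ...     | no i≢lo = Linked-dropLast-filterRange⁻ (suc lo) M
                        (subst (Linked _ ∘ dropLast) (sym eq) (Linked.tail linked))
                        (Consecutive-shrink c i≢lo) (HasLater-shrink (Consecutive-lo≤right c) later)
  ...     | yes refl with Consecutive-to-head c eq | HasLater⇒nonempty-tail (suc lo) M eq
  ...       | refl | nonempty with ys
  ...         | [] = ⊥-elim (nonempty (HasLater-shrink (Consecutive-lo≤right c) later) refl)
  ...         | _ ∷ _ = Linked.head linked

  Linked-dropLast-filterRange⁺ : ∀ {R : ℕ → ℕ → Set} lo M →
                                 (∀ {i i′} → Consecutive P lo M i i′ → HasLater P lo M i′ → R i i′) →
                                 Linked R (dropLast (filterRange lo M))
  Linked-dropLast-filterRange⁺ lo zero    R-cons = []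
  Linked-dropLast-filterRange⁺ lo (suc M) R-cons with P? lo
  ... | no _ = Linked-dropLast-filterRange⁺ (suc lo) M (λ c later → R-cons (Consecutive-grow c) (HasLater-grow later))
  ... | yes P-lo with filterRange (suc lo) M in eq
                    | Linked-dropLast-filterRange⁺ (suc lo) M (λ c later → R-cons (Consecutive-grow c) (HasLater-grow later))
  ...   | []         | _      = []
  ...   | _ ∷ []     | _      = [-]
  ...   | y ∷ z ∷ zs | linked = R-cons (Consecutive-from-head P-lo eq) later ∷ linked
    where
    later : HasLater P lo (suc M) y
    later with subst (All _) eq (filterRange-all (suc lo) M) | filterRange-increasing (suc lo) M eq
    ... | _ ∷ (z∈ , P-z) ∷ _ | y<z ∷ _ = z , InRange-suc z∈ , y<z , P-z

-- The cyclic condition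

-- ℕ ∖ {k} ordered cyclically starting just above k.
data _≺⟨_⟩_ : ℕ → ℕ → ℕ → Set where
  above : ∀ {k x y} → k < x → x < y → x ≺⟨ k ⟩ y
  below : ∀ {k x y} → x < y → y < k → x ≺⟨ k ⟩ y
  wrap  : ∀ {k x y} → k < x → y < k → x ≺⟨ k ⟩ y

≺-above⇒< : ∀ {k x y} → x ≺⟨ k ⟩ y → k < y → x < y
≺-above⇒< (above _ x<y) _   = x<y
≺-above⇒< (below _ y<k) k<y = ⊥-elim (ℕ.<-asym y<k k<y)
≺-above⇒< (wrap _ y<k)  k<y = ⊥-elim (ℕ.<-asym y<k k<y)

≺-below⇒< : ∀ {k x y} → x ≺⟨ k ⟩ y → x < k → x < y
≺-below⇒< (above k<x _) x<k = ⊥-elim (ℕ.<-asym k<x x<k)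
≺-below⇒< (below x<y _) _   = x<y
≺-below⇒< (wrap k<x _)  x<k = ⊥-elim (ℕ.<-asym k<x x<k)

≺-below-above : ∀ {k x y} → x < k → k < y → ¬ x ≺⟨ k ⟩ y
≺-below-above x<k _   (above k<x _) = ℕ.<-asym k<x x<k
≺-below-above _   k<y (below _ y<k) = ℕ.<-asym k<y y<k
≺-below-above x<k _   (wrap k<x _)  = ℕ.<-asym k<x x<k

module _ {k : ℕ} where

  StrictInc-++-∷⁻ : ∀ D A → StrictInc (D ++ k ∷ A) → StrictInc D × All (_< k) D × StrictInc (k ∷ A)
  StrictInc-++-∷⁻ []            A inc = [] , [] , inc
  StrictInc-++-∷⁻ (x ∷ [])      A (x<k ∷ inc) = [-] , x<k ∷ [] , inc
  StrictInc-++-∷⁻ (x ∷ y ∷ D)   A (x<y ∷ inc) with StrictInc-++-∷⁻ (y ∷ D) A inc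
  ... | incD , y<k ∷ D<k , incA = x<y ∷ incD , ℕ.<-trans x<y y<k ∷ y<k ∷ D<k , incA

  StrictInc-++-∷⁺ : ∀ D A → StrictInc D → All (_< k) D → StrictInc (k ∷ A) → StrictInc (D ++ k ∷ A)
  StrictInc-++-∷⁺ []          A _           _          incA = incA
  StrictInc-++-∷⁺ (x ∷ [])    A _           (x<k ∷ []) incA = x<k ∷ incA
  StrictInc-++-∷⁺ (x ∷ y ∷ D) A (x<y ∷ incD) (_ ∷ D<k) incA = x<y ∷ StrictInc-++-∷⁺ (y ∷ D) A incD D<k incA

  Linked-≺-below : ∀ D → StrictInc D → All (_< k) D → Linked _≺⟨ k ⟩_ D
  Linked-≺-below []          _            _              = []
  Linked-≺-below (x ∷ [])    _            _              = [-]
  Linked-≺-below (x ∷ y ∷ D) (x<y ∷ incD) (_ ∷ y<k ∷ D<k) =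
    below x<y y<k ∷ Linked-≺-below (y ∷ D) incD (y<k ∷ D<k)

  Linked-≺-above-below : ∀ A D → StrictInc (k ∷ A) → StrictInc D → All (_< k) D → Linked _≺⟨ k ⟩_ (A ++ D)
  Linked-≺-above-below []          D _                   incD D<k = Linked-≺-below D incD D<k
  Linked-≺-above-below (x ∷ [])    [] _                  _    _   = [-]
  Linked-≺-above-below (x ∷ [])    (y ∷ D) (k<x ∷ _)     incD (y<k ∷ D<k) =
    wrap k<x y<k ∷ Linked-≺-below (y ∷ D) incD (y<k ∷ D<k)
  Linked-≺-above-below (x ∷ y ∷ A) D (k<x ∷ x<y ∷ incA) incD D<k =
    above k<x x<y ∷ Linked-≺-above-below (y ∷ A) D (ℕ.<-trans k<x x<y ∷ incA) incD D<k

  rotation⇒Linked-≺ : ∀ ys t → StrictInc (drop t ys ++ k ∷ take t ys) → Linked _≺⟨ k ⟩_ ys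
  rotation⇒Linked-≺ ys t inc with StrictInc-++-∷⁻ (drop t ys) (take t ys) inc
  ... | incD , D<k , incA =
    subst (Linked _≺⟨ k ⟩_) (take++drop≡id t ys) (Linked-≺-above-below (take t ys) (drop t ys) incA incD D<k)

  ≺-cons-above : ∀ {y} ys t → k < y → Linked _≺⟨ k ⟩_ (y ∷ ys) →
                 StrictInc (k ∷ take t ys) → StrictInc (k ∷ y ∷ take t ys)
  ≺-cons-above ys       zero    k<y _            _           = k<y ∷ [-]
  ≺-cons-above []       (suc t) k<y _            _           = k<y ∷ [-]
  ≺-cons-above (z ∷ zs) (suc t) k<y (y≺z ∷ _) (k<z ∷ inc) = k<y ∷ ≺-above⇒< y≺z k<z ∷ inc

  ≺-cons-below : ∀ {y} ys t → y < k → Linked _≺⟨ k ⟩_ (y ∷ ys) →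
                 StrictInc (drop t ys ++ k ∷ take t ys) → StrictInc (y ∷ ys ++ k ∷ [])
  ≺-cons-below []       t       y<k _         _   = y<k ∷ [-]
  ≺-cons-below (z ∷ zs) zero    y<k (y≺z ∷ _) inc = ≺-below⇒< y≺z y<k ∷ inc
  ≺-cons-below (z ∷ zs) (suc t) y<k (y≺z ∷ _) inc with StrictInc-++-∷⁻ (drop t zs) (z ∷ take t zs) inc
  ... | _ , _ , k<z ∷ _ = ⊥-elim (≺-below-above y<k k<z y≺z)

  Linked-≺⇒rotation : ∀ ys → All (_≢ k) ys → Linked _≺⟨ k ⟩_ ys →
                      ∃ λ t → t ≤ length ys × StrictInc (drop t ys ++ k ∷ take t ys)
  Linked-≺⇒rotation []       _            _      = 0 , z≤n , [-]
  Linked-≺⇒rotation (y ∷ ys) (y≢k ∷ ys≢k) linked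
    with Linked-≺⇒rotation ys ys≢k (Linked.tail linked) | ℕ.<-cmp y k
  ... | _           | tri≈ _ y≡k _ = ⊥-elim (y≢k y≡k)
  ... | t , _  , inc | tri< y<k _ _ = 0 , z≤n , ≺-cons-below ys t y<k linked inc
  ... | t , t≤ , inc | tri> _ _ k<y with StrictInc-++-∷⁻ (drop t ys) (take t ys) inc
  ...   | incD , D<k , incA =
    suc t , s≤s t≤ , StrictInc-++-∷⁺ (drop t ys) (y ∷ take t ys) incD D<k (≺-cons-above ys t k<y linked incA)

CycCond⇒Linked-≺ : ∀ k cs → CycCond k cs → Linked _≺⟨ k ⟩_ (dropLast cs)
CycCond⇒Linked-≺ k cs (j , _ , j≤ , inc) = rotation⇒Linked-≺ (dropLast cs) (j ∸ 1)
  (subst (λ A → StrictInc (drop (j ∸ 1) (dropLast cs) ++ k ∷ A))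
         (sym (take-dropLast (j ∸ 1) cs (ℕ.∸-monoˡ-≤ 1 j≤))) inc)

Linked-≺⇒CycCond : ∀ k cs → 1 ≤ length cs → All (_≢ k) (dropLast cs) →
                   Linked _≺⟨ k ⟩_ (dropLast cs) → CycCond k cs
Linked-≺⇒CycCond k cs 1≤len ≢k linked with Linked-≺⇒rotation (dropLast cs) ≢k linked
... | t , t≤ , inc = suc t , s≤s z≤n , suc-t≤ ,
  subst (λ A → StrictInc (drop t (dropLast cs) ++ k ∷ A)) (take-dropLast t cs t≤′) inc
  where
  t≤′ : t ≤ length cs ∸ 1
  t≤′ = subst (t ≤_) (length-dropLast cs) t≤
  suc-t≤ : suc t ≤ length cs
  suc-t≤ = ℕ.≤-trans (s≤s t≤′) (ℕ.≤-reflexive (ℕ.m+[n∸m]≡n 1≤len))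

module Congruence (n : ℕ) where

  infix 4 _≈_

  -- A wrapper around x ≡[ n ] y that lets Agda infer x and y from a proof.
  record _≈_ (x y : ℤ) : Set where
    constructor ⟨_⟩
    field unwrap : x ≡[ n ] y
  open _≈_ public

  _≈?_ : ∀ x y → Dec (x ≈ y)
  x ≈? y with (+ n) ∣? (x - y)
  ... | yes x≈y = yes ⟨ x≈y ⟩
  ... | no x≉y  = no (x≉y ∘ unwrap)

  ≈-reflexive : ∀ {x y} → x ≡ y → x ≈ y
  ≈-reflexive {x} refl = ⟨ divides (+ 0) (x-x≡0*n x (+ n)) ⟩
    where
    x-x≡0*n : ∀ x n → x - x ≡ + 0 * n
    x-x≡0*n = solve-∀

  ≈-refl : ∀ {x} → x ≈ x
  ≈-refl = ≈-reflexive refl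

  ≈-sym : ∀ {x y} → x ≈ y → y ≈ x
  ≈-sym {x} {y} ⟨ n∣x-y ⟩ = ⟨ subst ((+ n) ∣_) (-[x-y]≡y-x x y) (∣m⇒∣-m n∣x-y) ⟩
    where
    -[x-y]≡y-x : ∀ x y → - (x - y) ≡ y - x
    -[x-y]≡y-x = solve-∀

  ≈-trans : ∀ {x y z} → x ≈ y → y ≈ z → x ≈ z
  ≈-trans {x} {y} {z} ⟨ n∣x-y ⟩ ⟨ n∣y-z ⟩ =
    ⟨ subst ((+ n) ∣_) (ℤ.+-minus-telescope x y z) (∣m∣n⇒∣m+n n∣x-y n∣y-z) ⟩

  ≈-isEquivalence : IsEquivalence _≈_
  ≈-isEquivalence = record { refl = ≈-refl ; sym = ≈-sym ; trans = ≈-trans }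

  ≈-setoid : Setoid 0ℓ 0ℓ
  ≈-setoid = record { isEquivalence = ≈-isEquivalence }

  module ≈-Reasoning = SetoidReasoning ≈-setoid

  +-multiple≈ : ∀ x q → x + q * + n ≈ x
  +-multiple≈ x q = ⟨ divides q (x+y-x≡y x (q * + n)) ⟩
    where
    x+y-x≡y : ∀ x y → x + y - x ≡ y
    x+y-x≡y = solve-∀

  ≈⇒+-multiple : ∀ {x y} → x ≈ y → ∃ λ q → x ≡ y + q * + n
  ≈⇒+-multiple {x} {y} ⟨ divides q x-y≡q*n ⟩ = q , trans (x≡y+[x-y] x y) (cong (λ t → y + t) x-y≡q*n)
    where
    x≡y+[x-y] : ∀ x y → x ≡ y + (x - y)
    x≡y+[x-y] = solve-∀

  ≈-+ʳ : ∀ {x y} z → x ≈ y → x + z ≈ y + z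
  ≈-+ʳ {x} {y} z ⟨ n∣x-y ⟩ = ⟨ subst ((+ n) ∣_) (sym ([x+z]-[y+z]≡x-y x y z)) n∣x-y ⟩
    where
    [x+z]-[y+z]≡x-y : ∀ x y z → (x + z) - (y + z) ≡ x - y
    [x+z]-[y+z]≡x-y = solve-∀

  ≈-+ˡ : ∀ {x y} z → x ≈ y → z + x ≈ z + y
  ≈-+ˡ {x} {y} z x≈y = subst₂ _≈_ (ℤ.+-comm x z) (ℤ.+-comm y z) (≈-+ʳ z x≈y)

  n≈0 : + n ≈ + 0
  n≈0 = ⟨ divides (+ 1) (n-0≡1*n (+ n)) ⟩
    where
    n-0≡1*n : ∀ n → n - + 0 ≡ + 1 * n
    n-0≡1*n = solve-∀

  -n≈ : ∀ x → x - + n ≈ x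
  -n≈ x = subst (_≈ x) (x+[-1]*n≡x-n x (+ n)) (+-multiple≈ x (- + 1))
    where
    x+[-1]*n≡x-n : ∀ x n → x + - + 1 * n ≡ x - n
    x+[-1]*n≡x-n = solve-∀

module Residues (n : ℕ) .⦃ _ : NonZero n ⦄ where
  open Congruence n

  private
    multiple<n≡0 : ∀ t → t < n → n ℕ.∣ t → t ≡ 0
    multiple<n≡0 zero    _   _   = refl
    multiple<n≡0 (suc t) t<n n∣t = ⊥-elim (ℕ.>⇒∤ t<n n∣t)

    +-≈-ordered : ∀ {r r′} → r ≤ r′ → r′ ∸ r < n → + r′ ≈ + r → r ≡ r′
    +-≈-ordered {r} {r′} r≤r′ r′-r<n ⟨ n∣r′-r ⟩ =
      ℕ.≤-antisym r≤r′ (ℕ.m∸n≡0⇒m≤n (multiple<n≡0 (r′ ∸ r) r′-r<n (∣⇒∣ᵤ n∣r′∸r)))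
      where
      n∣r′∸r : (+ n) ∣ + (r′ ∸ r)
      n∣r′∸r = subst ((+ n) ∣_) (trans (ℤ.m-n≡m⊖n r′ r) (ℤ.⊖-≥ r≤r′)) n∣r′-r

    window : ∀ {lo r r′} → lo ≤ r → r′ < lo ℕ.+ n → r′ ∸ r < n
    window {lo} {r} {r′} lo≤r r′< = ℕ.≤-<-trans (ℕ.∸-monoʳ-≤ r′ lo≤r) (ℕ.m<n+o⇒m∸n<o r′ lo r′<)

  +-≈-window : ∀ {lo r r′} → lo ≤ r → lo ≤ r′ → r < lo ℕ.+ n → r′ < lo ℕ.+ n →
               + r ≈ + r′ → r ≡ r′
  +-≈-window lo≤r lo≤r′ r< r′< r≈r′ with ℕ.≤-total _ _
  ... | inj₁ r≤r′ = +-≈-ordered r≤r′ (window lo≤r r′<) (≈-sym r≈r′)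
  ... | inj₂ r′≤r = sym (+-≈-ordered r′≤r (window lo≤r′ r<) r≈r′)

  ≈-%ℕ : ∀ x → x ≈ + (x %ℕ n)
  ≈-%ℕ x = subst (_≈ + (x %ℕ n)) (sym (a≡a%ℕn+[a/ℕn]*n x n)) (+-multiple≈ _ (x /ℕ n))

  %ℕ-cong : ∀ {x y} → x ≈ y → x %ℕ n ≡ y %ℕ n
  %ℕ-cong {x} {y} x≈y = +-≈-window z≤n z≤n (n%ℕd<d x n) (n%ℕd<d y n)
    (≈-trans (≈-sym (≈-%ℕ x)) (≈-trans x≈y (≈-%ℕ y)))

  res≈ : ∀ x → + (res n x) ≈ x
  res≈ x with x %ℕ n | ≈-%ℕ x
  ... | zero  | x≈0 = ≈-trans n≈0 (≈-sym x≈0)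
  ... | suc r | x≈r = ≈-sym x≈r

  res-cong : ∀ {x y} → x ≈ y → res n x ≡ res n y
  res-cong {x} {y} x≈y with x %ℕ n | y %ℕ n | %ℕ-cong x≈y
  ... | zero  | .zero    | refl = refl
  ... | suc r | .(suc r) | refl = refl

  res-injective : ∀ x y → res n x ≡ res n y → x ≈ y
  res-injective x y eq = ≈-trans (≈-sym (res≈ x)) (subst (λ r → + r ≈ y) (sym eq) (res≈ y))

  1≤res : ∀ x → 1 ≤ res n x
  1≤res x with x %ℕ n
  ... | zero  = ℕ.>-nonZero⁻¹ n
  ... | suc r = s≤s z≤n

  res≤n : ∀ x → res n x ≤ n
  res≤n x with x %ℕ n | n%ℕd<d x n
  ... | zero  | _   = ℕ.≤-refl
  ... | suc r | r<n = ℕ.<⇒≤ r<n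

  +-≈-[1,n] : ∀ {r r′} → 1 ≤ r → 1 ≤ r′ → r ≤ n → r′ ≤ n → + r ≈ + r′ → r ≡ r′
  +-≈-[1,n] 1≤r 1≤r′ r≤n r′≤n = +-≈-window 1≤r 1≤r′ (s≤s r≤n) (s≤s r′≤n)

  res-+ : ∀ {c} → 1 ≤ c → c ≤ n → res n (+ c) ≡ c
  res-+ {c} 1≤c c≤n = +-≈-[1,n] (1≤res (+ c)) 1≤c (res≤n (+ c)) c≤n (res≈ (+ c))

  offset : ℕ → ℕ → ℕ
  offset v x = (+ x - + v) %ℕ n

  offset-unique : ∀ v x {e} → e < n → + e ≈ + x - + v → offset v x ≡ e
  offset-unique v x e<n e≈ =
    +-≈-window z≤n z≤n (n%ℕd<d (+ x - + v) n) e<n (≈-trans (≈-sym (≈-%ℕ _)) (≈-sym e≈))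

  private
    +-∸ : ∀ {x v} → v ≤ x → + (x ∸ v) ≡ + x - + v
    +-∸ {x} {v} v≤x = sym (trans (ℤ.m-n≡m⊖n x v) (ℤ.⊖-≥ v≤x))

  offset-self : ∀ v → offset v v ≡ 0
  offset-self v = offset-unique v v (ℕ.>-nonZero⁻¹ n) (≈-reflexive (sym (ℤ.+-inverseʳ (+ v))))

  offset-above : ∀ {v x} → 1 ≤ v → v < x → x ≤ n → offset v x ≡ x ∸ v
  offset-above {v} {x} 1≤v v<x x≤n =
    offset-unique v x (ℕ.<-≤-trans (ℕ.∸-monoʳ-< 1≤v (ℕ.<⇒≤ v<x)) x≤n) (≈-reflexive (+-∸ (ℕ.<⇒≤ v<x)))

  offset-below : ∀ {v x} → x < v → v ≤ n → offset v x ≡ x ℕ.+ n ∸ v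
  offset-below {v} {x} x<v v≤n = offset-unique v x x+n∸v<n (≈-trans (≈-reflexive (+-∸ v≤x+n)) x+n-v≈x-v)
    where
    v≤x+n : v ≤ x ℕ.+ n
    v≤x+n = ℕ.≤-trans v≤n (ℕ.m≤n+m n x)
    x+n∸v<n : x ℕ.+ n ∸ v < n
    x+n∸v<n = ℕ.m<n+o⇒m∸n<o (x ℕ.+ n) v (ℕ.+-monoˡ-< n x<v)
    x+n-v≈x-v : + (x ℕ.+ n) - + v ≈ + x - + v
    x+n-v≈x-v = subst (λ t → t - + v ≈ + x - + v) (sym (ℤ.pos-+ x n))
                  (≈-+ʳ (- + v) (subst (+ x + + n ≈_) (ℤ.+-identityʳ (+ x)) (≈-+ˡ (+ x) n≈0)))

  module _ {k : ℕ} (1≤k : 1 ≤ k) (k<n : k < n) where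

    private
      ∸-cancelʳ-< : ∀ {x y} → x ∸ k < y ∸ k → x < y
      ∸-cancelʳ-< x∸k<y∸k = ℕ.≰⇒> (λ y≤x → ℕ.<⇒≱ x∸k<y∸k (ℕ.∸-monoˡ-≤ k y≤x))

      k≤n : k ≤ n
      k≤n = ℕ.<⇒≤ k<n

    ≺⇒offset< : ∀ {x y} → x ≤ n → 1 ≤ y → y ≤ n → x ≺⟨ k ⟩ y → offset k x < offset k y
    ≺⇒offset< {x} {y} x≤n 1≤y y≤n (above k<x x<y) rewrite offset-above 1≤k k<x x≤n | offset-above 1≤k (ℕ.<-trans k<x x<y) y≤n =
      ℕ.∸-monoˡ-< x<y (ℕ.<⇒≤ k<x)
    ≺⇒offset< {x} {y} x≤n 1≤y y≤n (below x<y y<k) rewrite offset-below (ℕ.<-trans x<y y<k) k≤n | offset-below y<k k≤n =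
      ℕ.∸-monoˡ-< (ℕ.+-monoˡ-< n x<y) (ℕ.≤-trans k≤n (ℕ.m≤n+m n x))
    ≺⇒offset< {x} {y} x≤n 1≤y y≤n (wrap k<x y<k) rewrite offset-above 1≤k k<x x≤n | offset-below y<k k≤n =
      ℕ.∸-monoˡ-< (ℕ.≤-<-trans x≤n (ℕ.m<n+m n 1≤y)) (ℕ.<⇒≤ k<x)

    offset<⇒≺ : ∀ {x y} → x ≢ k → y ≢ k → x ≤ n → y ≤ n → offset k x < offset k y → x ≺⟨ k ⟩ y
    offset<⇒≺ {x} {y} x≢k y≢k x≤n y≤n off< with ℕ.<-cmp x k | ℕ.<-cmp y k
    ... | tri≈ _ x≡k _ | _            = ⊥-elim (x≢k x≡k)
    ... | _            | tri≈ _ y≡k _ = ⊥-elim (y≢k y≡k)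
    ... | tri> _ _ k<x | tri> _ _ k<y rewrite offset-above 1≤k k<x x≤n | offset-above 1≤k k<y y≤n =
      above k<x (∸-cancelʳ-< off<)
    ... | tri< x<k _ _ | tri< y<k _ _ rewrite offset-below x<k k≤n | offset-below y<k k≤n =
      below (ℕ.+-cancelʳ-< n x y (∸-cancelʳ-< off<)) y<k
    ... | tri> _ _ k<x | tri< y<k _ _ = wrap k<x y<k
    ... | tri< x<k _ _ | tri> _ _ k<y rewrite offset-below x<k k≤n | offset-above 1≤k k<y y≤n =
      ⊥-elim (ℕ.<⇒≱ off< (ℕ.∸-monoˡ-≤ k (ℕ.≤-trans y≤n (ℕ.m≤n+m n x))))

module Reflections (n : ℕ) where
  open Congruence n

  reflect-≈ˡ : ∀ {i j x} → x ≈ i → refl⟨ n ⟩ i j x ≡ x - i + j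
  reflect-≈ˡ {i} {j} {x} ⟨ x≡i ⟩ with (+ n) ∣? (x - i)
  ... | yes _   = refl
  ... | no x≢i  = ⊥-elim (x≢i x≡i)

  reflect-≈ʳ : ∀ {i j x} → ¬ x ≈ i → x ≈ j → refl⟨ n ⟩ i j x ≡ x - j + i
  reflect-≈ʳ {i} {j} {x} x≉i ⟨ x≡j ⟩ with (+ n) ∣? (x - i)
  ... | yes x≡i = ⊥-elim (x≉i ⟨ x≡i ⟩)
  ... | no _ with (+ n) ∣? (x - j)
  ...   | yes _   = refl
  ...   | no x≢j  = ⊥-elim (x≢j x≡j)

  reflect-≉ : ∀ {i j x} → ¬ x ≈ i → ¬ x ≈ j → refl⟨ n ⟩ i j x ≡ x
  reflect-≉ {i} {j} {x} x≉i x≉j with (+ n) ∣? (x - i)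
  ... | yes x≡i = ⊥-elim (x≉i ⟨ x≡i ⟩)
  ... | no _ with (+ n) ∣? (x - j)
  ...   | yes x≡j = ⊥-elim (x≉j ⟨ x≡j ⟩)
  ...   | no _    = refl

  Equivariant : (ℤ → ℤ) → Set
  Equivariant f = ∀ x q → f (x + q * + n) ≡ f x + q * + n

  Equivariant⇒≈-cong : ∀ f → Equivariant f → ∀ {x y} → x ≈ y → f x ≈ f y
  Equivariant⇒≈-cong f f-eq {y = y} x≈y with ≈⇒+-multiple x≈y
  ... | q , refl = subst (_≈ f y) (sym (f-eq y q)) (+-multiple≈ (f y) q)

  private
    x-i+j≡x+[j-i] : ∀ x i j → x - i + j ≡ x + (j - i)
    x-i+j≡x+[j-i] = solve-∀

    x-j+i≡x-[j-i] : ∀ x i j → x - j + i ≡ x - (j - i)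
    x-j+i≡x-[j-i] = solve-∀

    x+t-i+j≡x-i+j+t : ∀ x t i j → x + t - i + j ≡ x - i + j + t
    x+t-i+j≡x-i+j+t = solve-∀

    i+t-i+j≡j+t : ∀ i t j → i + t - i + j ≡ j + t
    i+t-i+j≡j+t = solve-∀

  ≈-move : ∀ {x i} j → x ≈ i → x - i + j ≈ j
  ≈-move {x} {i} j ⟨ n∣x-i ⟩ = ⟨ subst ((+ n) ∣_) (x-i≡x-i+j-j x i j) n∣x-i ⟩
    where
    x-i≡x-i+j-j : ∀ x i j → x - i ≡ x - i + j - j
    x-i≡x-i+j-j = solve-∀

  reflect-equivariant : ∀ i j → Equivariant (refl⟨ n ⟩ i j)
  reflect-equivariant i j x q with x ≈? i | x ≈? j
  ... | yes x≈i | _ = begin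
    refl⟨ n ⟩ i j (x + q * + n) ≡⟨ reflect-≈ˡ (≈-trans (+-multiple≈ x q) x≈i) ⟩
    x + q * + n - i + j         ≡⟨ x+t-i+j≡x-i+j+t x (q * + n) i j ⟩
    x - i + j + q * + n         ≡⟨ cong (_+ q * + n) (sym (reflect-≈ˡ x≈i)) ⟩
    refl⟨ n ⟩ i j x + q * + n   ∎
    where open ≡-Reasoning
  ... | no x≉i | yes x≈j = begin
    refl⟨ n ⟩ i j (x + q * + n) ≡⟨ reflect-≈ʳ (x≉i ∘ ≈-trans (≈-sym (+-multiple≈ x q))) (≈-trans (+-multiple≈ x q) x≈j) ⟩
    x + q * + n - j + i         ≡⟨ x+t-i+j≡x-i+j+t x (q * + n) j i ⟩
    x - j + i + q * + n         ≡⟨ cong (_+ q * + n) (sym (reflect-≈ʳ x≉i x≈j)) ⟩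
    refl⟨ n ⟩ i j x + q * + n   ∎
    where open ≡-Reasoning
  ... | no x≉i | no x≉j = begin
    refl⟨ n ⟩ i j (x + q * + n) ≡⟨ reflect-≉ (x≉i ∘ ≈-trans (≈-sym (+-multiple≈ x q))) (x≉j ∘ ≈-trans (≈-sym (+-multiple≈ x q))) ⟩
    x + q * + n                 ≡⟨ cong (_+ q * + n) (sym (reflect-≉ x≉i x≉j)) ⟩
    refl⟨ n ⟩ i j x + q * + n   ∎
    where open ≡-Reasoning

  reflect-involutive : ∀ {i j} → ¬ i ≈ j → ∀ x → refl⟨ n ⟩ i j (refl⟨ n ⟩ i j x) ≡ x
  reflect-involutive {i} {j} i≉j x with x ≈? i | x ≈? j
  ... | yes x≈i | _ = begin
    refl⟨ n ⟩ i j (refl⟨ n ⟩ i j x) ≡⟨ cong (refl⟨ n ⟩ i j) (reflect-≈ˡ x≈i) ⟩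
    refl⟨ n ⟩ i j (x - i + j)       ≡⟨ reflect-≈ʳ (λ y≈i → i≉j (≈-trans (≈-sym y≈i) (≈-move j x≈i))) (≈-move j x≈i) ⟩
    x - i + j - j + i               ≡⟨ x-i+j-j+i≡x x i j ⟩
    x                               ∎
    where
    open ≡-Reasoning
    x-i+j-j+i≡x : ∀ x i j → x - i + j - j + i ≡ x
    x-i+j-j+i≡x = solve-∀
  ... | no x≉i | yes x≈j = begin
    refl⟨ n ⟩ i j (refl⟨ n ⟩ i j x) ≡⟨ cong (refl⟨ n ⟩ i j) (reflect-≈ʳ x≉i x≈j) ⟩
    refl⟨ n ⟩ i j (x - j + i)       ≡⟨ reflect-≈ˡ (≈-move i x≈j) ⟩
    x - j + i - i + j               ≡⟨ x-j+i-i+j≡x x i j ⟩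
    x                               ∎
    where
    open ≡-Reasoning
    x-j+i-i+j≡x : ∀ x i j → x - j + i - i + j ≡ x
    x-j+i-i+j≡x = solve-∀
  ... | no x≉i | no x≉j = trans (cong (refl⟨ n ⟩ i j) (reflect-≉ x≉i x≉j)) (reflect-≉ x≉i x≉j)

  ≈-difference : ∀ {i j i′ j′} → i ≈ i′ → j - i ≡ j′ - i′ → j ≈ j′
  ≈-difference {i} {j} {i′} {j′} i≈i′ j-i≡j′-i′ =
    subst₂ _≈_ (j-i+i≡j i j) (trans (cong (_+ i′) j-i≡j′-i′) (j-i+i≡j i′ j′)) (≈-+ˡ (j - i) i≈i′)
    where
    j-i+i≡j : ∀ i j → j - i + i ≡ j
    j-i+i≡j = solve-∀

  reflect-cong : ∀ {i j i′ j′} → i ≈ i′ → j - i ≡ j′ - i′ → ∀ x → refl⟨ n ⟩ i j x ≡ refl⟨ n ⟩ i′ j′ x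
  reflect-cong {i} {j} {i′} {j′} i≈i′ j-i≡j′-i′ x with x ≈? i | x ≈? j
  ... | yes x≈i | _ = begin
    refl⟨ n ⟩ i j x     ≡⟨ reflect-≈ˡ x≈i ⟩
    x - i + j           ≡⟨ x-i+j≡x+[j-i] x i j ⟩
    x + (j - i)         ≡⟨ cong (λ t → x + t) j-i≡j′-i′ ⟩
    x + (j′ - i′)       ≡⟨ x-i+j≡x+[j-i] x i′ j′ ⟨
    x - i′ + j′         ≡⟨ reflect-≈ˡ (≈-trans x≈i i≈i′) ⟨
    refl⟨ n ⟩ i′ j′ x   ∎
    where open ≡-Reasoning
  ... | no x≉i | yes x≈j = begin
    refl⟨ n ⟩ i j x     ≡⟨ reflect-≈ʳ x≉i x≈j ⟩
    x - j + i           ≡⟨ x-j+i≡x-[j-i] x i j ⟩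
    x - (j - i)         ≡⟨ cong (λ t → x - t) j-i≡j′-i′ ⟩
    x - (j′ - i′)       ≡⟨ x-j+i≡x-[j-i] x i′ j′ ⟨
    x - j′ + i′         ≡⟨ reflect-≈ʳ (x≉i ∘ (λ x≈i′ → ≈-trans x≈i′ (≈-sym i≈i′))) (≈-trans x≈j (≈-difference i≈i′ j-i≡j′-i′)) ⟨
    refl⟨ n ⟩ i′ j′ x   ∎
    where open ≡-Reasoning
  ... | no x≉i | no x≉j = begin
    refl⟨ n ⟩ i j x     ≡⟨ reflect-≉ x≉i x≉j ⟩
    x                   ≡⟨ reflect-≉ (x≉i ∘ (λ x≈i′ → ≈-trans x≈i′ (≈-sym i≈i′))) (x≉j ∘ (λ x≈j′ → ≈-trans x≈j′ (≈-sym (≈-difference i≈i′ j-i≡j′-i′)))) ⟨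
    refl⟨ n ⟩ i′ j′ x   ∎
    where open ≡-Reasoning

  Equivariant-move : ∀ g → Equivariant g → ∀ {y i} j → y ≈ i → g (y - i + j) ≡ g y - g i + g j
  Equivariant-move g g-eq {i = i} j y≈i with ≈⇒+-multiple y≈i
  ... | q , refl = begin
    g (i + q * + n - i + j)       ≡⟨ cong g (i+t-i+j≡j+t i (q * + n) j) ⟩
    g (j + q * + n)               ≡⟨ g-eq j q ⟩
    g j + q * + n                 ≡⟨ i+t-i+j≡j+t (g i) (q * + n) (g j) ⟨
    g i + q * + n - g i + g j     ≡⟨ cong (λ t → t - g i + g j) (g-eq i q) ⟨
    g (i + q * + n) - g i + g j   ∎
    where open ≡-Reasoning

  reflect-conjugate : ∀ g h → Equivariant g → Equivariant h → (∀ x → h (g x) ≡ x) →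
                      ∀ i j y → g (refl⟨ n ⟩ i j y) ≡ refl⟨ n ⟩ (g i) (g j) (g y)
  reflect-conjugate g h g-eq h-eq hg i j y with y ≈? i | y ≈? j
  ... | yes y≈i | _ = begin
    g (refl⟨ n ⟩ i j y)               ≡⟨ cong g (reflect-≈ˡ y≈i) ⟩
    g (y - i + j)                     ≡⟨ Equivariant-move g g-eq j y≈i ⟩
    g y - g i + g j                   ≡⟨ reflect-≈ˡ (Equivariant⇒≈-cong g g-eq y≈i) ⟨
    refl⟨ n ⟩ (g i) (g j) (g y)       ∎
    where open ≡-Reasoning
  ... | no y≉i | yes y≈j = begin
    g (refl⟨ n ⟩ i j y)               ≡⟨ cong g (reflect-≈ʳ y≉i y≈j) ⟩
    g (y - j + i)                     ≡⟨ Equivariant-move g g-eq i y≈j ⟩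
    g y - g j + g i                   ≡⟨ reflect-≈ʳ (y≉i ∘ reflect) (Equivariant⇒≈-cong g g-eq y≈j) ⟨
    refl⟨ n ⟩ (g i) (g j) (g y)       ∎
    where
    open ≡-Reasoning
    reflect : ∀ {z} → g y ≈ g z → y ≈ z
    reflect gy≈gz = subst₂ _≈_ (hg y) (hg _) (Equivariant⇒≈-cong h h-eq gy≈gz)
  ... | no y≉i | no y≉j = trans (cong g (reflect-≉ y≉i y≉j)) (sym (reflect-≉ (y≉i ∘ reflect) (y≉j ∘ reflect)))
    where
    reflect : ∀ {z} → g y ≈ g z → y ≈ z
    reflect gy≈gz = subst₂ _≈_ (hg y) (hg _) (Equivariant⇒≈-cong h h-eq gy≈gz)

  module _ (r : ℕ → ℤ → ℤ) where

    lprod-equivariant : ∀ k → (∀ i → i < k → Equivariant (r (suc i))) → Equivariant (lprod r k)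
    lprod-equivariant zero    _      x q = refl
    lprod-equivariant (suc k) r-eq x q = begin
      lprod r k (r (suc k) (x + q * + n))   ≡⟨ cong (lprod r k) (r-eq k (ℕ.n<1+n k) x q) ⟩
      lprod r k (r (suc k) x + q * + n)     ≡⟨ lprod-equivariant k (λ i → r-eq i ∘ ℕ.m<n⇒m<1+n) _ q ⟩
      lprod r k (r (suc k) x) + q * + n     ∎
      where open ≡-Reasoning

    rprod-equivariant : ∀ k → (∀ i → i < k → Equivariant (r (suc i))) → Equivariant (rprod r k)
    rprod-equivariant zero    _      x q = refl
    rprod-equivariant (suc k) r-eq x q = begin
      r (suc k) (rprod r k (x + q * + n))   ≡⟨ cong (r (suc k)) (rprod-equivariant k (λ i → r-eq i ∘ ℕ.m<n⇒m<1+n) x q) ⟩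
      r (suc k) (rprod r k x + q * + n)     ≡⟨ r-eq k (ℕ.n<1+n k) _ q ⟩
      r (suc k) (rprod r k x) + q * + n     ∎
      where open ≡-Reasoning

module _ (r : ℕ → ℤ → ℤ) where

  lprod∘rprod : ∀ k → (∀ i → i < k → ∀ x → r (suc i) (r (suc i) x) ≡ x) → ∀ x → lprod r k (rprod r k x) ≡ x
  lprod∘rprod zero    _   x = refl
  lprod∘rprod (suc k) inv x =
    trans (cong (lprod r k) (inv k (ℕ.n<1+n k) _)) (lprod∘rprod k (λ i → inv i ∘ ℕ.m<n⇒m<1+n) x)

  rprod∘lprod : ∀ k → (∀ i → i < k → ∀ x → r (suc i) (r (suc i) x) ≡ x) → ∀ x → rprod r k (lprod r k x) ≡ x
  rprod∘lprod zero    _   x = refl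
  rprod∘lprod (suc k) inv x =
    trans (cong (r (suc k)) (rprod∘lprod k (λ i → inv i ∘ ℕ.m<n⇒m<1+n) (r (suc k) x))) (inv k (ℕ.n<1+n k) x)

-- Tree-like factorizations of λ_n

module Factorization (n : ℕ) .⦃ _ : NonZero n ⦄ (2≤n : 2 ≤ n) (a b : ℕ → ℤ) (T : TreeLike n a b) where
  open Congruence n
  open Residues n
  open Reflections n
  open TreeLike T renaming (cong to a≡b)

  private
    x+[y-x]≡y : ∀ x y → x + (y - x) ≡ y
    x+[y-x]≡y = solve-∀

    x+y-x≡y : ∀ x y → x + y - x ≡ y
    x+y-x≡y = solve-∀

    x+y-y≡x : ∀ x y → x + y - y ≡ x
    x+y-y≡x = solve-∀

    x-y+y≡x : ∀ x y → x - y + y ≡ x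
    x-y+y≡x = solve-∀

  lam-∣ : ∀ {x} → (+ n) ∣ x → lam n x ≡ x - + (n ℕ.* (n ∸ 1))
  lam-∣ {x} n∣x with (+ n) ∣? x
  ... | yes _  = refl
  ... | no n∤x = ⊥-elim (n∤x n∣x)

  lam-∤ : ∀ {x} → ¬ (+ n) ∣ x → lam n x ≡ x + + n
  lam-∤ {x} n∤x with (+ n) ∣? x
  ... | yes n∣x = ⊥-elim (n∤x n∣x)
  ... | no _    = refl

  N : ℕ
  N = 2 ℕ.* n ∸ 2

  r : ℕ → ℤ → ℤ
  r = reflSeq n a b

  L F : ℕ → ℤ → ℤ
  L = lprod r
  F = rprod r

  d : ℕ → ℤ
  d k = b (suc k) - a k

  p : ℕ → ℤ
  p zero    = a 0
  p (suc k) = p k + d k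

  private
    suc<N⇒≤2n∸3 : ∀ {k} → suc k < N → suc k ≤ 2 ℕ.* n ∸ 3
    suc<N⇒≤2n∸3 {k} k+1<N = subst (suc k ≤_) (ℕ.∸-+-assoc (2 ℕ.* n) 2 1) (ℕ.∸-monoˡ-≤ 1 k+1<N)

  p≈a : ∀ k → k < N → p k ≈ a k
  p≈b : ∀ k → k < N → p (suc k) ≈ b (suc k)
  p≈a zero    _       = ≈-refl
  p≈a (suc k) k+1<N = ≈-trans (p≈b k (ℕ.<-trans (ℕ.n<1+n k) k+1<N)) (≈-sym ⟨ a≡b (suc k) (s≤s z≤n) (suc<N⇒≤2n∸3 k+1<N) ⟩)
  p≈b k k<N = ≈-trans (≈-+ʳ (d k) (p≈a k k<N)) (≈-reflexive (x+[y-x]≡y (a k) (b (suc k))))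

  p≉p-suc : ∀ k → k < N → ¬ p k ≈ p (suc k)
  p≉p-suc k k<N pk≈pk+1 =
    isRefl (suc k) (s≤s z≤n) k<N (unwrap (≈-trans (≈-sym (p≈a k k<N)) (≈-trans pk≈pk+1 (p≈b k k<N))))

  0<d : ∀ k → k < N → + 0 ℤ.< d k
  0<d k k<N = subst (ℤ._< d k) (ℤ.+-inverseʳ (a k)) (ℤ.+-monoˡ-< (- a k) (lt (suc k) (s≤s z≤n) k<N))

  r≗reflect : ∀ k → k < N → ∀ x → r (suc k) x ≡ refl⟨ n ⟩ (p k) (p (suc k)) x
  r≗reflect k k<N = reflect-cong (≈-sym (p≈a k k<N)) (sym (x+y-x≡y (p k) (d k)))

  r-down : ∀ k → k < N → ∀ {x} → x ≈ p (suc k) → r (suc k) x ≡ x - d k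
  r-down k k<N {x} x≈p′ = trans (r≗reflect k k<N x) (trans (reflect-≈ʳ x≉p x≈p′) (x-[p+d]+p≡x-d x (p k) (d k)))
    where
    x≉p : ¬ x ≈ p k
    x≉p x≈p = p≉p-suc k k<N (≈-trans (≈-sym x≈p) x≈p′)
    x-[p+d]+p≡x-d : ∀ x p d → x - (p + d) + p ≡ x - d
    x-[p+d]+p≡x-d = solve-∀

  r-fixed : ∀ k → k < N → ∀ {x} → ¬ x ≈ p k → ¬ x ≈ p (suc k) → r (suc k) x ≡ x
  r-fixed k k<N {x} x≉p x≉p′ = trans (r≗reflect k k<N x) (reflect-≉ x≉p x≉p′)

  r-involutive : ∀ k → k < N → ∀ x → r (suc k) (r (suc k) x) ≡ x
  r-involutive k k<N x = begin
    r (suc k) (r (suc k) x)                             ≡⟨ r≗reflect k k<N _ ⟩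
    refl⟨ n ⟩ (p k) (p (suc k)) (r (suc k) x)           ≡⟨ cong (refl⟨ n ⟩ (p k) (p (suc k))) (r≗reflect k k<N x) ⟩
    refl⟨ n ⟩ (p k) (p (suc k)) (refl⟨ n ⟩ (p k) (p (suc k)) x) ≡⟨ reflect-involutive (p≉p-suc k k<N) x ⟩
    x                                                   ∎
    where open ≡-Reasoning

  L-equivariant : ∀ k → Equivariant (L k)
  L-equivariant k = lprod-equivariant r k (λ i _ → reflect-equivariant (a i) (b (suc i)))

  F-equivariant : ∀ k → Equivariant (F k)
  F-equivariant k = rprod-equivariant r k (λ i _ → reflect-equivariant (a i) (b (suc i)))

  private
    involutive-below : ∀ k → k ≤ N → ∀ i → i < k → ∀ x → r (suc i) (r (suc i) x) ≡ x
    involutive-below k k≤N i i<k = r-involutive i (ℕ.<-≤-trans i<k k≤N)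

  L∘F : ∀ k → k ≤ N → ∀ x → L k (F k x) ≡ x
  L∘F k k≤N = lprod∘rprod r k (involutive-below k k≤N)

  F∘L : ∀ k → k ≤ N → ∀ x → F k (L k x) ≡ x
  F∘L k k≤N = rprod∘lprod r k (involutive-below k k≤N)

  F-≈-cong : ∀ k {x y} → x ≈ y → F k x ≈ F k y
  F-≈-cong k = Equivariant⇒≈-cong (F k) (F-equivariant k)

  L-≈-cong : ∀ k {x y} → x ≈ y → L k x ≈ L k y
  L-≈-cong k = Equivariant⇒≈-cong (L k) (L-equivariant k)

  F-≈-injective : ∀ k → k ≤ N → ∀ {x y} → F k x ≈ F k y → x ≈ y
  F-≈-injective k k≤N {x} {y} Fx≈Fy = subst₂ _≈_ (L∘F k k≤N x) (L∘F k k≤N y) (L-≈-cong k Fx≈Fy)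

  L-≈-injective : ∀ k → k ≤ N → ∀ {x y} → L k x ≈ L k y → x ≈ y
  L-≈-injective k k≤N {x} {y} Lx≈Ly = subst₂ _≈_ (F∘L k k≤N x) (F∘L k k≤N y) (F-≈-cong k Lx≈Ly)

  L-p : ∀ k → k ≤ N → L k (p k) ≡ p 0
  L-p zero    _     = refl
  L-p (suc k) k<N = trans (cong (L k) (trans (r-down k k<N ≈-refl) (x+y-y≡x (p k) (d k)))) (L-p k (ℕ.<⇒≤ k<N))

  F-p : ∀ k → k ≤ N → F k (p 0) ≡ p k
  F-p k k≤N = trans (cong (F k) (sym (L-p k k≤N))) (F∘L k k≤N (p k))

  x<x+d : ∀ k → k < N → ∀ x → x ℤ.< x + d k
  x<x+d k k<N x = subst (ℤ._< x + d k) (ℤ.+-identityʳ x) (ℤ.+-monoʳ-< x (0<d k k<N))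

  p0≤p : ∀ k → k ≤ N → p 0 ℤ.≤ p k
  p0≤p zero    _   = ℤ.≤-refl
  p0≤p (suc k) k<N = ℤ.≤-trans (p0≤p k (ℕ.<⇒≤ k<N)) (ℤ.<⇒≤ (x<x+d k k<N (p k)))

  p0<pN : p 0 ℤ.< p N
  p0<pN = subst (λ k → p 0 ℤ.< p k) (ℕ.suc-pred N ⦃ ℕ.>-nonZero 0<N ⦄)
            (ℤ.≤-<-trans (p0≤p (ℕ.pred N) (ℕ.<⇒≤ pred<N)) (x<x+d (ℕ.pred N) pred<N _))
    where
    0<N : 0 < N
    0<N = ℕ.<-≤-trans (s≤s z≤n) (ℕ.∸-monoˡ-≤ 2 (ℕ.*-monoʳ-≤ 2 2≤n))
    pred<N : ℕ.pred N < N
    pred<N = ℕ.≤-reflexive (ℕ.suc-pred N ⦃ ℕ.>-nonZero 0<N ⦄)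

  lam-pN : lam n (p N) ≡ p 0
  lam-pN = trans (sym (product (p N))) (L-p N ℕ.≤-refl)

  -- λ_n (p N) = p 0 < p N rules out λ_n (p N) = p N + n, so n ∣ p N and p 0 = p N - n (n - 1).
  p0≈0 : p 0 ≈ + 0
  p0≈0 with (+ n) ∣? p N
  ... | yes n∣pN = subst (_≈ + 0) (trans (sym (lam-∣ n∣pN)) lam-pN) (≈-trans pN-n[n-1]≈pN ⟨ subst ((+ n) ∣_) (sym (ℤ.+-identityʳ (p N))) n∣pN ⟩)
    where
    pN-n[n-1]≈pN : p N - + (n ℕ.* (n ∸ 1)) ≈ p N
    pN-n[n-1]≈pN = subst (_≈ p N)
      (trans (x+[-m]*n≡x-n*m (p N) (+ n) (+ (n ∸ 1))) (cong (λ t → p N - t) (sym (ℤ.pos-* n (n ∸ 1)))))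
      (+-multiple≈ (p N) (- + (n ∸ 1)))
      where
      x+[-m]*n≡x-n*m : ∀ x n m → x + - m * n ≡ x - n * m
      x+[-m]*n≡x-n*m = solve-∀
  ... | no n∤pN = ⊥-elim (ℤ.<-asym p0<pN (subst (p N ℤ.<_) (trans (sym (lam-∤ n∤pN)) lam-pN) pN<pN+n))
    where
    pN<pN+n : p N ℤ.< p N + + n
    pN<pN+n = subst (ℤ._< p N + + n) (ℤ.+-identityʳ (p N)) (ℤ.+-monoʳ-< (p N) (+<+ (ℕ.>-nonZero⁻¹ n)))

  m : ℕ → ℤ
  m j = L (j ∸ 1) (p j) - p 0

  L-p-suc≈m : ∀ k → L k (p (suc k)) ≈ m (suc k)
  L-p-suc≈m k = subst₂ _≈_ (x-y+y≡x (L k (p (suc k))) (p 0)) (ℤ.+-identityʳ (m (suc k))) (≈-+ˡ (m (suc k)) p0≈0)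

  L-p-suc≉p0 : ∀ k → k < N → ¬ L k (p (suc k)) ≈ p 0
  L-p-suc≉p0 k k<N L≈p0 =
    p≉p-suc k k<N (≈-sym (L-≈-injective k (ℕ.<⇒≤ k<N) (≈-trans L≈p0 (≈-reflexive (sym (L-p k (ℕ.<⇒≤ k<N)))))))

  m≉0 : ∀ k → k < N → ¬ (+ 0) ≡[ n ] m (suc k)
  m≉0 k k<N 0≈m = L-p-suc≉p0 k k<N (≈-trans (L-p-suc≈m k) (≈-trans (≈-sym ⟨ 0≈m ⟩) (≈-sym p0≈0)))

  conjugate : ∀ k → k < N → ∀ x → (L k ∘ r (suc k) ∘ F k) x ≡ refl⟨ n ⟩ (+ 0) (m (suc k)) x
  conjugate k k<N x = begin
    L k (r (suc k) (F k x))                                     ≡⟨ cong (L k) (r≗reflect k k<N (F k x)) ⟩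
    L k (refl⟨ n ⟩ (p k) (p (suc k)) (F k x))                   ≡⟨ reflect-conjugate (L k) (F k) (L-equivariant k) (F-equivariant k) (F∘L k k≤N) _ _ _ ⟩
    refl⟨ n ⟩ (L k (p k)) (L k (p (suc k))) (L k (F k x))       ≡⟨ cong₂ (λ i y → refl⟨ n ⟩ i (L k (p (suc k))) y) (L-p k k≤N) (L∘F k k≤N x) ⟩
    refl⟨ n ⟩ (p 0) (L k (p (suc k))) x                         ≡⟨ reflect-cong p0≈0 (sym (ℤ.+-identityʳ (m (suc k)))) x ⟩
    refl⟨ n ⟩ (+ 0) (m (suc k)) x                               ∎
    where
    open ≡-Reasoning
    k≤N : k ≤ N
    k≤N = ℕ.<⇒≤ k<N

  Token : ℕ → Set
  Token c = InRange 1 (n ∸ 1) c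

  -- The residue of m j (by L-p-suc≈m).
  token : ℕ → ℕ
  token j = res n (L (j ∸ 1) (p j))

  1+[n-1]≡n : 1 ℕ.+ (n ∸ 1) ≡ n
  1+[n-1]≡n = ℕ.m+[n∸m]≡n (ℕ.>-nonZero⁻¹ n)

  Token⇒<n : ∀ {c} → Token c → c < n
  Token⇒<n {c} (_ , c<) = subst (c <_) 1+[n-1]≡n c<

  Token⇒≉p0 : ∀ {c} → Token c → ¬ + c ≈ p 0
  Token⇒≉p0 c∈@(1≤c , _) c≈p0 =
    ℕ.<⇒≢ 1≤c (sym (+-≈-window z≤n z≤n (Token⇒<n c∈) (ℕ.>-nonZero⁻¹ n) (≈-trans c≈p0 p0≈0)))

  res-Token : ∀ {c} → Token c → res n (+ c) ≡ c
  res-Token c∈@(1≤c , _) = res-+ 1≤c (ℕ.<⇒≤ (Token⇒<n c∈))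

  token∈ : ∀ {k} → k < N → Token (token (suc k))
  token∈ {k} k<N = 1≤res (L k (p (suc k))) , subst (token (suc k) <_) (sym 1+[n-1]≡n) (ℕ.≤∧≢⇒< (res≤n (L k (p (suc k)))) token≢n)
    where
    token≢n : token (suc k) ≢ n
    token≢n eq = L-p-suc≉p0 k k<N
      (≈-trans (res-injective _ (+ n) (trans eq (sym (res-+ (ℕ.>-nonZero⁻¹ n) ℕ.≤-refl)))) (≈-trans n≈0 (≈-sym p0≈0)))

  F≉p : ∀ {c k} → Token c → k ≤ N → ¬ F k (+ c) ≈ p k
  F≉p {c} {k} c∈ k≤N Fc≈p = Token⇒≉p0 c∈ (F-≈-injective k k≤N (subst (F k (+ c) ≈_) (sym (F-p k k≤N)) Fc≈p))

  F≈p-suc⇒token : ∀ {c k} → Token c → k < N → F k (+ c) ≈ p (suc k) → token (suc k) ≡ c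
  F≈p-suc⇒token {c} {k} c∈ k<N Fc≈p′ =
    trans (res-cong (≈-sym (subst (_≈ L k (p (suc k))) (L∘F k (ℕ.<⇒≤ k<N) (+ c)) (L-≈-cong k Fc≈p′)))) (res-Token c∈)

  token⇒F≈p-suc : ∀ {c k} → Token c → k < N → token (suc k) ≡ c → F k (+ c) ≈ p (suc k)
  token⇒F≈p-suc {c} {k} c∈ k<N token≡c =
    ≈-sym (subst (_≈ F k (+ c)) (F∘L k (ℕ.<⇒≤ k<N) _) (F-≈-cong k (res-injective _ (+ c) (trans token≡c (sym (res-Token c∈))))))

  F-hit : ∀ {c k} → Token c → k < N → token (suc k) ≡ c → F (suc k) (+ c) ≡ F k (+ c) - d k
  F-hit c∈ k<N token≡c = r-down _ k<N (token⇒F≈p-suc c∈ k<N token≡c)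

  F-miss : ∀ {c k} → Token c → k < N → token (suc k) ≢ c → F (suc k) (+ c) ≡ F k (+ c)
  F-miss c∈ k<N token≢c = r-fixed _ k<N (F≉p c∈ (ℕ.<⇒≤ k<N)) (token≢c ∘ F≈p-suc⇒token c∈ k<N)

  F-stay : ∀ {c} → Token c → ∀ A B → A ≤ B → B ≤ N →
           (∀ k → A ≤ k → k < B → token (suc k) ≢ c) → F B (+ c) ≡ F A (+ c)
  F-stay c∈ A zero    z≤n _   _     = refl
  F-stay c∈ A (suc B) A≤B+1 B<N avoid with ℕ.m≤n⇒m<n∨m≡n A≤B+1
  ... | inj₂ refl = refl
  ... | inj₁ A≤B  = trans (F-miss c∈ B<N (avoid B (ℕ.≤-pred A≤B) ℕ.≤-refl))
                          (F-stay c∈ A B (ℕ.≤-pred A≤B) (ℕ.<⇒≤ B<N) (λ k A≤k k<B → avoid k A≤k (ℕ.m<n⇒m<1+n k<B)))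

  -- F N = λ_n⁻¹, and λ_n (c - n) = c because c - n ≢ 0 (mod n).
  F-N : ∀ {c} → Token c → F N (+ c) ≡ + c - + n
  F-N {c} c∈ = begin
    F N (+ c)                   ≡⟨ cong (F N) (x-y+y≡x (+ c) (+ n)) ⟨
    F N (+ c - + n + + n)       ≡⟨ cong (F N) (lam-∤ n∤c-n) ⟨
    F N (lam n (+ c - + n))     ≡⟨ cong (F N) (sym (product _)) ⟩
    F N (L N (+ c - + n))       ≡⟨ F∘L N ℕ.≤-refl _ ⟩
    + c - + n                   ∎
    where
    open ≡-Reasoning
    n∤c-n : ¬ (+ n) ∣ (+ c - + n)
    n∤c-n n∣c-n = Token⇒≉p0 c∈ (≈-trans (≈-sym (-n≈ (+ c))) (≈-trans ⟨ subst ((+ n) ∣_) (sym (ℤ.+-identityʳ _)) n∣c-n ⟩ (≈-sym p0≈0)))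

  -≈-p : ∀ k {x} → x ≈ p (suc k) → x - d k ≈ p k
  -≈-p k x≈p′ = ≈-trans (≈-+ʳ _ x≈p′) (≈-reflexive (x+y-y≡x (p k) (d k)))

  tokenCount : ℕ → ℕ
  tokenCount c = count (token ∘ suc) c 0 N

  tokenCount≢0 : ∀ {c} → Token c → tokenCount c ≢ 0
  tokenCount≢0 {c} c∈ none = ℤ.<-irrefl c-n≡c (x-n<x (+ c))
    where
    c-n≡c : + c - + n ≡ + c
    c-n≡c = trans (sym (F-N c∈)) (F-stay c∈ 0 N z≤n ℕ.≤-refl (λ k _ k<N → count≡0 (token ∘ suc) c 0 N none k (z≤n , k<N)))
    x-n<x : ∀ x → x - + n ℤ.< x
    x-n<x x = subst (x - + n ℤ.<_) (x-y+y≡x x (+ n)) (subst (ℤ._< x - + n + + n) (ℤ.+-identityʳ _) (ℤ.+-monoʳ-< (x - + n) (+<+ (ℕ.>-nonZero⁻¹ n))))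

  -- A token that moves only once would end up on p f ≢ p (f + 1) instead of on c - n ≡ c.
  tokenCount≢1 : ∀ {c} → Token c → tokenCount c ≢ 1
  tokenCount≢1 {c} c∈ once with count≡1 (token ∘ suc) c 0 N once
  ... | record { pos = f ; pos∈ = _ , f<N ; t-pos = token≡c ; only = only } =
    p≉p-suc f f<N (begin
      p f               ≈⟨ after ⟨
      F (suc f) (+ c)   ≡⟨ stay-after ⟨
      F N (+ c)         ≡⟨ F-N c∈ ⟩
      + c - + n         ≈⟨ -n≈ (+ c) ⟩
      + c               ≈⟨ before ⟩
      p (suc f)         ∎)
    where
    open ≈-Reasoning
    stay-before : F f (+ c) ≡ + c
    stay-before = F-stay c∈ 0 f z≤n (ℕ.<⇒≤ f<N)
      (λ k _ k<f token≡c → ℕ.<⇒≢ k<f (only k (z≤n , ℕ.<-trans k<f f<N) token≡c))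
    before : + c ≈ p (suc f)
    before = subst (_≈ p (suc f)) stay-before (token⇒F≈p-suc c∈ f<N token≡c)
    after : F (suc f) (+ c) ≈ p f
    after = subst (_≈ p f) (sym (F-hit c∈ f<N token≡c)) (-≈-p f (token⇒F≈p-suc c∈ f<N token≡c))
    stay-after : F N (+ c) ≡ F (suc f) (+ c)
    stay-after = F-stay c∈ (suc f) N f<N ℕ.≤-refl
      (λ k f<k k<N token≡c → ℕ.<⇒≢ f<k (sym (only k (z≤n , k<N) token≡c)))

  2≤tokenCount : ∀ {c} → Token c → 2 ≤ tokenCount c
  2≤tokenCount c∈ = ℕ.≤∧≢⇒< (ℕ.n≢0⇒n>0 (tokenCount≢0 c∈)) (tokenCount≢1 c∈ ∘ sym)

  -- N = 2 (n - 1) steps carry n - 1 tokens, each at least twice.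
  tokenCount≡2 : ∀ {c} → Token c → tokenCount c ≡ 2
  tokenCount≡2 {c} c∈ = sumRange-tight tokenCount 1 (n ∸ 1) (λ _ → 2≤tokenCount) total c c∈
    where
    total : sumRange tokenCount 1 (n ∸ 1) ≡ (n ∸ 1) ℕ.* 2
    total = trans (sumRange-count (token ∘ suc) 0 N 1 (n ∸ 1) (λ _ (_ , k<N) → token∈ k<N))
                  (trans (sym (ℕ.*-distribˡ-∸ 2 n 1)) (ℕ.*-comm 2 (n ∸ 1)))

  L-near-F : ∀ k → k ≤ N → ∀ {y w} → w ≈ F k y → L k w ≡ y + (w - F k y)
  L-near-F k k≤N {y} {w} w≈Fy with ≈⇒+-multiple w≈Fy
  ... | q , refl = begin
    L k (F k y + q * + n)       ≡⟨ L-equivariant k (F k y) q ⟩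
    L k (F k y) + q * + n       ≡⟨ cong (_+ q * + n) (L∘F k k≤N y) ⟩
    y + q * + n                 ≡⟨ cong (λ t → y + t) (x+y-x≡y (F k y) (q * + n)) ⟨
    y + (F k y + q * + n - F k y) ∎
    where
    open ≡-Reasoning

  record TokenSteps (c : ℕ) : Set where
    field
      f g           : ℕ
      f<g           : f < g
      g<N           : g < N
      token-f       : token (suc f) ≡ c
      token-g       : token (suc g) ≡ c
      only          : ∀ k → k < N → token (suc k) ≡ c → k ≡ f ⊎ k ≡ g
      d-f+d-g≡n     : d f + d g ≡ + n
      p-suc-f≈c     : p (suc f) ≈ + c
      p-suc-g≈p-f   : p (suc g) ≈ p f
      p-g≈c         : p g ≈ + c
      p≉c-before    : ∀ k → k ≤ f → ¬ p k ≈ + c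
      p≉p-f-between : ∀ k → f < k → k ≤ g → ¬ p k ≈ p f
      p≉c-after     : ∀ k → g < k → k ≤ N → ¬ p k ≈ + c
      m-f           : m (suc f) ≡ p (suc f) - p 0
      m-g           : m (suc g) ≡ p (suc g) + d f - p 0

    f<N : f < N
    f<N = ℕ.<-trans f<g g<N

  module TokenMoves {c} (c∈ : Token c) (two : TwoOccurrences (token ∘ suc) c 0 N) where
    open TwoOccurrences two
      renaming (first to f; second to g; first<second to f<g; t-first to token-f; t-second to token-g)

    private
      f<N : f < N
      f<N = proj₂ first∈

      g<N : g < N
      g<N = proj₂ second∈

      only′ : ∀ k → k < N → token (suc k) ≡ c → k ≡ f ⊎ k ≡ g
      only′ k k<N = only k (z≤n , k<N)

      avoid : ∀ k → k < N → k ≢ f → k ≢ g → token (suc k) ≢ c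
      avoid k k<N k≢f k≢g = [ k≢f , k≢g ]′ ∘ only′ k k<N

      F-before : ∀ k → k ≤ f → F k (+ c) ≡ + c
      F-before k k≤f = F-stay c∈ 0 k z≤n (ℕ.<⇒≤ (ℕ.≤-<-trans k≤f f<N)) (λ j _ j<k → before-f (ℕ.<-≤-trans j<k k≤f))
        where
        before-f : ∀ {j} → j < f → token (suc j) ≢ c
        before-f j<f = avoid _ (ℕ.<-trans j<f f<N) (ℕ.<⇒≢ j<f) (ℕ.<⇒≢ (ℕ.<-trans j<f f<g))

      F-between : ∀ k → f < k → k ≤ g → F k (+ c) ≡ + c - d f
      F-between k f<k k≤g = begin
        F k (+ c)          ≡⟨ F-stay c∈ (suc f) k f<k (ℕ.≤-trans k≤g (ℕ.<⇒≤ g<N))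
                                (λ j f<j j<k → avoid j (ℕ.<-trans j<k (ℕ.≤-<-trans k≤g g<N)) (ℕ.<⇒≢ f<j ∘ sym)
                                                     (ℕ.<⇒≢ (ℕ.<-≤-trans j<k k≤g))) ⟩
        F (suc f) (+ c)    ≡⟨ F-hit c∈ f<N token-f ⟩
        F f (+ c) - d f    ≡⟨ cong (_- d f) (F-before f ℕ.≤-refl) ⟩
        + c - d f          ∎
        where open ≡-Reasoning

      F-after : ∀ k → g < k → k ≤ N → F k (+ c) ≡ + c - + n
      F-after k g<k k≤N = begin
        F k (+ c)          ≡⟨ F-stay c∈ k N k≤N ℕ.≤-refl
                                (λ j k≤j j<N → avoid j j<N (ℕ.<⇒≢ (ℕ.<-≤-trans (ℕ.<-trans f<g g<k) k≤j) ∘ sym)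
                                                     (ℕ.<⇒≢ (ℕ.<-≤-trans g<k k≤j) ∘ sym)) ⟨
        F N (+ c)          ≡⟨ F-N c∈ ⟩
        + c - + n          ∎
        where open ≡-Reasoning

      F-f≈ : F f (+ c) ≈ p (suc f)
      F-f≈ = token⇒F≈p-suc c∈ f<N token-f

      F-g≈ : F g (+ c) ≈ p (suc g)
      F-g≈ = token⇒F≈p-suc c∈ g<N token-g

      F-g : F g (+ c) ≡ + c - d f
      F-g = F-between g f<g ℕ.≤-refl

      p-suc≈F⇒ : ∀ k → k < N → p (suc k) ≈ F k (+ c) → k ≡ f ⊎ k ≡ g
      p-suc≈F⇒ k k<N p≈F = only′ k k<N (F≈p-suc⇒token c∈ k<N (≈-sym p≈F))

      p-f≈ : p f ≈ + c - d f
      p-f≈ = ≈-sym (subst (_≈ p f) (cong (_- d f) (F-before f ℕ.≤-refl)) (-≈-p f F-f≈))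

      d-f+d-g≡n : d f + d g ≡ + n
      d-f+d-g≡n = begin
        d f + d g                  ≡⟨ a+b≡x-[x-a-b] (+ c) (d f) (d g) ⟩
        + c - (+ c - d f - d g)    ≡⟨ cong (λ t → + c - (t - d g)) F-g ⟨
        + c - (F g (+ c) - d g)    ≡⟨ cong (λ t → + c - t) (F-hit c∈ g<N token-g) ⟨
        + c - F (suc g) (+ c)      ≡⟨ cong (λ t → + c - t) (F-after (suc g) ℕ.≤-refl g<N) ⟩
        + c - (+ c - + n)          ≡⟨ x-[x-n]≡n (+ c) (+ n) ⟩
        + n                        ∎
        where
        open ≡-Reasoning
        a+b≡x-[x-a-b] : ∀ x a b → a + b ≡ x - (x - a - b)
        a+b≡x-[x-a-b] = solve-∀
        x-[x-n]≡n : ∀ x n → x - (x - n) ≡ n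
        x-[x-n]≡n = solve-∀

      p-suc-f≈c : p (suc f) ≈ + c
      p-suc-f≈c = ≈-sym (subst (_≈ p (suc f)) (F-before f ℕ.≤-refl) F-f≈)

      p-suc-g≈p-f : p (suc g) ≈ p f
      p-suc-g≈p-f = ≈-trans (≈-sym (subst (_≈ p (suc g)) F-g F-g≈)) (≈-sym p-f≈)

      p-g≈c : p g ≈ + c
      p-g≈c = begin
        p g                ≈⟨ -≈-p g F-g≈ ⟨
        F g (+ c) - d g    ≡⟨ F-hit c∈ g<N token-g ⟨
        F (suc g) (+ c)    ≡⟨ F-after (suc g) ℕ.≤-refl g<N ⟩
        + c - + n          ≈⟨ -n≈ (+ c) ⟩
        + c                ∎
        where open ≈-Reasoning

      p≉c-before : ∀ k → k ≤ f → ¬ p k ≈ + c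
      p≉c-before zero     _       p0≈c = Token⇒≉p0 c∈ (≈-sym p0≈c)
      p≉c-before (suc k) k<f p≈c =
        [ (λ k≡f → ℕ.<-irrefl k≡f k<f) , (λ k≡g → ℕ.<-irrefl k≡g (ℕ.<-trans k<f f<g)) ]′
        (p-suc≈F⇒ k (ℕ.<-trans k<f f<N) (≈-trans p≈c (≈-reflexive (sym (F-before k (ℕ.<⇒≤ k<f))))))

      p≉p-f-between : ∀ k → f < k → k ≤ g → ¬ p k ≈ p f
      p≉p-f-between (suc k) f<k+1 k<g p≈p-f =
        [ moved-again , (λ f≡k → p≉p-suc f f<N (subst (λ j → p f ≈ p (suc j)) (sym f≡k) (≈-sym p≈p-f))) ]′
        (ℕ.m<1+n⇒m<n∨m≡n f<k+1)
        where
        moved-again : f < k → ⊥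
        moved-again f<k = [ (λ k≡f → ℕ.<-irrefl (sym k≡f) f<k) , (λ k≡g → ℕ.<-irrefl k≡g k<g) ]′
          (p-suc≈F⇒ k (ℕ.<-trans k<g g<N) (≈-trans p≈p-f (≈-trans p-f≈ (≈-reflexive (sym (F-between k f<k (ℕ.<⇒≤ k<g)))))))

      p≉c-after : ∀ k → g < k → k ≤ N → ¬ p k ≈ + c
      p≉c-after (suc k) g<k+1 k<N p≈c =
        [ moved-again , (λ g≡k → p≉p-suc f f<N (≈-trans (≈-sym p-suc-g≈p-f)
                                   (≈-trans (subst (λ j → p (suc j) ≈ + c) (sym g≡k) p≈c) (≈-sym p-suc-f≈c)))) ]′
        (ℕ.m<1+n⇒m<n∨m≡n g<k+1)
        where
        moved-again : g < k → ⊥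
        moved-again g<k = [ (λ k≡f → ℕ.<-asym f<g (subst (g <_) k≡f g<k)) , (λ k≡g → ℕ.<-irrefl (sym k≡g) g<k) ]′
          (p-suc≈F⇒ k k<N (≈-trans p≈c (≈-trans (≈-sym (-n≈ (+ c))) (≈-reflexive (sym (F-after k g<k (ℕ.<⇒≤ k<N)))))))

      m-f : m (suc f) ≡ p (suc f) - p 0
      m-f = cong (_- p 0) (begin
        L f (p (suc f))                       ≡⟨ L-near-F f (ℕ.<⇒≤ f<N) (≈-sym F-f≈) ⟩
        + c + (p (suc f) - F f (+ c))         ≡⟨ cong (λ t → + c + (p (suc f) - t)) (F-before f ℕ.≤-refl) ⟩
        + c + (p (suc f) - + c)               ≡⟨ x+[y-x]≡y (+ c) (p (suc f)) ⟩
        p (suc f)                             ∎)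
        where
        open ≡-Reasoning

      m-g : m (suc g) ≡ p (suc g) + d f - p 0
      m-g = cong (_- p 0) (begin
        L g (p (suc g))                       ≡⟨ L-near-F g (ℕ.<⇒≤ g<N) (≈-sym F-g≈) ⟩
        + c + (p (suc g) - F g (+ c))         ≡⟨ cong (λ t → + c + (p (suc g) - t)) F-g ⟩
        + c + (p (suc g) - (+ c - d f))       ≡⟨ x+[y-[x-e]]≡y+e (+ c) (p (suc g)) (d f) ⟩
        p (suc g) + d f                       ∎)
        where
        open ≡-Reasoning
        x+[y-[x-e]]≡y+e : ∀ x y e → x + (y - (x - e)) ≡ y + e
        x+[y-[x-e]]≡y+e = solve-∀

    tokenSteps : TokenSteps c
    tokenSteps = record
      { f = f ; g = g ; f<g = f<g ; g<N = g<N ; token-f = token-f ; token-g = token-g ; only = only′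
      ; d-f+d-g≡n = d-f+d-g≡n ; p-suc-f≈c = p-suc-f≈c ; p-suc-g≈p-f = p-suc-g≈p-f ; p-g≈c = p-g≈c
      ; p≉c-before = p≉c-before ; p≉p-f-between = p≉p-f-between ; p≉c-after = p≉c-after
      ; m-f = m-f ; m-g = m-g }

  tokenSteps : ∀ {c} → Token c → TokenSteps c
  tokenSteps c∈ = TokenMoves.tokenSteps c∈ (count≡2 (token ∘ suc) _ 0 N (tokenCount≡2 c∈))

  stepSteps : ∀ {k} → k < N → TokenSteps (token (suc k))
  stepSteps k<N = tokenSteps (token∈ k<N)

  module _ {c} (t : TokenSteps c) where
    open TokenSteps t

    d-f<n : d f ℤ.< + n
    d-f<n = subst (d f ℤ.<_) d-f+d-g≡n (x<x+d g g<N (d f))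

    m-first : ∀ {k} → k ≡ f → m (suc k) ≡ p (suc k) - p 0
    m-first refl = m-f

    m-second : ∀ {k} → k ≡ g → m (suc k) ≡ p (suc k) + d f - p 0
    m-second refl = m-g

  step-first⊎second : ∀ {k} (k<N : k < N) → k ≡ TokenSteps.f (stepSteps k<N) ⊎ k ≡ TokenSteps.g (stepSteps k<N)
  step-first⊎second {k} k<N = TokenSteps.only (stepSteps k<N) k k<N refl

  Increasing : Set
  Increasing = ∀ j → 1 ≤ j → j < N → m j ℤ.< m (suc j)

  -- The only consecutive steps where Increasing is not automatic: step k is the second move
  -- of its token and step k + 1 the first move of the next one.
  IncreasingAtReturns : Set
  IncreasingAtReturns = ∀ {k c c′} (t : TokenSteps c) (t′ : TokenSteps c′) →
    k ≡ TokenSteps.g t → suc k ≡ TokenSteps.f t′ → d (TokenSteps.f t) ℤ.< d (suc k)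

  private
    +-<-cancel : ∀ P X Y Q → P + X - Q ℤ.< P + Y - Q → X ℤ.< Y
    +-<-cancel P X Y Q lt = subst₂ ℤ._<_ (Q-P+[P+X-Q]≡X P X Q) (Q-P+[P+X-Q]≡X P Y Q) (ℤ.+-monoʳ-< (Q - P) lt)
      where
      Q-P+[P+X-Q]≡X : ∀ P X Q → Q - P + (P + X - Q) ≡ X
      Q-P+[P+X-Q]≡X = solve-∀

    +-<-mono : ∀ P X Y Q → X ℤ.< Y → P + X - Q ℤ.< P + Y - Q
    +-<-mono P X Y Q X<Y = ℤ.+-monoˡ-< (- Q) (ℤ.+-monoʳ-< P X<Y)

  Increasing⇒IncreasingAtReturns : Increasing → IncreasingAtReturns
  Increasing⇒IncreasingAtReturns inc {k} t t′ k≡g k+1≡f′ =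
    +-<-cancel (p (suc k)) _ _ (p 0) (subst₂ ℤ._<_ (m-second t k≡g) (m-first t′ k+1≡f′) (inc (suc k) (s≤s z≤n) k+1<N))
    where
    k+1<N : suc k < N
    k+1<N = subst (_< N) (sym k+1≡f′) (TokenSteps.f<N t′)

  IncreasingAtReturns⇒Increasing : IncreasingAtReturns → Increasing
  IncreasingAtReturns⇒Increasing returns (suc k) _ k+1<N = by-cases (step-first⊎second k<N) (step-first⊎second k+1<N)
    where
    k<N : k < N
    k<N = ℕ.<-trans (ℕ.n<1+n k) k+1<N
    t = stepSteps k<N
    t′ = stepSteps k+1<N
    open TokenSteps t using (f; g)
    open TokenSteps t′ using () renaming (f to f′; g to g′)

    P+[X+Y]-Q≡P+X+Y-Q : ∀ P X Y Q → P + (X + Y) - Q ≡ P + X + Y - Q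
    P+[X+Y]-Q≡P+X+Y-Q = solve-∀

    by-cases : k ≡ f ⊎ k ≡ g → suc k ≡ f′ ⊎ suc k ≡ g′ → m (suc k) ℤ.< m (suc (suc k))
    by-cases (inj₁ k≡f) next = begin-strict
      m (suc k)                      ≡⟨ m-first t k≡f ⟩
      p (suc k) - p 0                <⟨ ℤ.+-monoˡ-< (- p 0) (x<x+d (suc k) k+1<N (p (suc k))) ⟩
      p (suc (suc k)) - p 0          ≤⟨ next-≤ next ⟩
      m (suc (suc k))                ∎
      where
      open ℤ.≤-Reasoning
      next-≤ : suc k ≡ f′ ⊎ suc k ≡ g′ → p (suc (suc k)) - p 0 ℤ.≤ m (suc (suc k))
      next-≤ (inj₁ k+1≡f′) = ℤ.≤-reflexive (sym (m-first t′ k+1≡f′))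
      next-≤ (inj₂ k+1≡g′) = ℤ.≤-trans (ℤ.<⇒≤ (ℤ.+-monoˡ-< (- p 0) (x<x+d f′ (TokenSteps.f<N t′) (p (suc (suc k))))))
                                       (ℤ.≤-reflexive (sym (m-second t′ k+1≡g′)))
    by-cases (inj₂ k≡g) (inj₁ k+1≡f′) = subst₂ ℤ._<_ (sym (m-second t k≡g)) (sym (m-first t′ k+1≡f′))
      (+-<-mono (p (suc k)) (d f) (d (suc k)) (p 0) (returns t t′ k≡g k+1≡f′))
    by-cases (inj₂ k≡g) (inj₂ k+1≡g′) = subst₂ ℤ._<_ (sym (m-second t k≡g))
      (trans (P+[X+Y]-Q≡P+X+Y-Q (p (suc k)) (d (suc k)) (d f′) (p 0)) (sym (m-second t′ k+1≡g′)))
      (+-<-mono (p (suc k)) (d f) (d (suc k) + d f′) (p 0) d-f<d+d-f′)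
      where
      d-f<d+d-f′ : d f ℤ.< d (suc k) + d f′
      d-f<d+d-f′ = subst (d f ℤ.<_)
        (trans (sym (TokenSteps.d-f+d-g≡n t′)) (trans (cong (λ j → d f′ + d j) (sym k+1≡g′)) (ℤ.+-comm (d f′) (d (suc k)))))
        (d-f<n t)

  0<d<n : ∀ {k} → k < N → + 0 ℤ.< d k × d k ℤ.< + n
  0<d<n {k} k<N = 0<d k k<N , [ d-first<n , d-second<n ]′ (step-first⊎second k<N)
    where
    open TokenSteps (stepSteps k<N)
    d-first<n : k ≡ f → d k ℤ.< + n
    d-first<n k≡f = subst (λ j → d j ℤ.< + n) (sym k≡f) (d-f<n (stepSteps k<N))
    d-second<n : k ≡ g → d k ℤ.< + n
    d-second<n k≡g = subst (λ j → d j ℤ.< + n) (sym k≡g)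
      (subst (d g ℤ.<_) (trans (ℤ.+-comm (d g) (d f)) d-f+d-g≡n) (x<x+d f f<N (d g)))

  ∣d∣ : ℕ → ℕ
  ∣d∣ k = ℤ.∣ d k ∣

  +∣d∣≡d : ∀ {k} → k < N → + ∣d∣ k ≡ d k
  +∣d∣≡d k<N = ℤ.0≤i⇒+∣i∣≡i (ℤ.<⇒≤ (proj₁ (0<d<n k<N)))

  ∣d∣<⇔d< : ∀ {k k′} → k < N → k′ < N → ∣d∣ k < ∣d∣ k′ ⇔ d k ℤ.< d k′
  ∣d∣<⇔d< k<N k′<N = mk⇔ (subst₂ ℤ._<_ (+∣d∣≡d k<N) (+∣d∣≡d k′<N) ∘ +<+)
                          (ℤ.drop‿+<+ ∘ subst₂ ℤ._<_ (sym (+∣d∣≡d k<N)) (sym (+∣d∣≡d k′<N)))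

  Departs : ℕ → ℕ → Set
  Departs v k = a k ≡[ n ] (+ v)

  departs? : ∀ v → Decidable (Departs v)
  departs? v k = (+ n) ∣? (a k - + v)

  target : ℕ → ℕ
  target k = res n (b (suc k))

  nb≡ : ∀ v → nb n a b v ≡ map target (filterRange (departs? v) 0 N)
  nb≡ v = begin
    map (λ i → res n (b i)) (filter (λ i → departs? v (i ∸ 1)) (oneTo N))
      ≡⟨ cong (map (λ i → res n (b i)) ∘ filter (λ i → departs? v (i ∸ 1))) (oneTo≡range N) ⟩
    map (λ i → res n (b i)) (filter (λ i → departs? v (i ∸ 1)) (range 1 N))
      ≡⟨ cong (map (λ i → res n (b i))) (filter-range-suc (λ i → departs? v (i ∸ 1)) 0 N) ⟩
    map (λ i → res n (b i)) (map suc (filterRange (departs? v) 0 N))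
      ≡⟨ map-∘ (filterRange (departs? v) 0 N) ⟨
    map target (filterRange (departs? v) 0 N) ∎
    where open ≡-Reasoning

  0<∣d∣<n : ∀ {k} → k < N → 0 < ∣d∣ k × ∣d∣ k < n
  0<∣d∣<n k<N = ℤ.drop‿+<+ (subst (+ 0 ℤ.<_) (sym (+∣d∣≡d k<N)) (proj₁ (0<d<n k<N)))
              , ℤ.drop‿+<+ (subst (ℤ._< + n) (sym (+∣d∣≡d k<N)) (proj₂ (0<d<n k<N)))

  Departs⇒p≈ : ∀ {v k} → k < N → Departs v k → p k ≈ + v
  Departs⇒p≈ k<N dep = ≈-trans (p≈a _ k<N) ⟨ dep ⟩

  p≈⇒Departs : ∀ {v k} → k < N → p k ≈ + v → Departs v k
  p≈⇒Departs k<N p≈v = unwrap (≈-trans (≈-sym (p≈a _ k<N)) p≈v)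

  target≈ : ∀ {v k} → k < N → Departs v k → + target k ≈ + v + + ∣d∣ k
  target≈ {v} {k} k<N dep = begin
    + target k        ≈⟨ res≈ (b (suc k)) ⟩
    b (suc k)         ≈⟨ p≈b k k<N ⟨
    p k + d k         ≈⟨ ≈-+ʳ (d k) (Departs⇒p≈ k<N dep) ⟩
    + v + d k         ≡⟨ cong (λ e → + v + e) (+∣d∣≡d k<N) ⟨
    + v + + ∣d∣ k     ∎
    where open ≈-Reasoning

  target-n : ∀ {k} → k < N → Departs n k → target k ≡ ∣d∣ k
  target-n {k} k<N dep = +-≈-[1,n] (1≤res (b (suc k))) (proj₁ (0<∣d∣<n k<N)) (res≤n (b (suc k))) (ℕ.<⇒≤ (proj₂ (0<∣d∣<n k<N)))
    (≈-trans (target≈ k<N dep) (≈-trans (≈-+ʳ (+ ∣d∣ k) n≈0) (≈-reflexive (ℤ.+-identityˡ (+ ∣d∣ k)))))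

  offset-target : ∀ {v k} → k < N → Departs v k → offset v (target k) ≡ ∣d∣ k
  offset-target {v} {k} k<N dep = offset-unique v (target k) (proj₂ (0<∣d∣<n k<N))
    (≈-sym (≈-trans (≈-+ʳ (ℤ.- + v) (target≈ k<N dep)) (≈-reflexive (x+y-x≡y (+ v) (+ ∣d∣ k)))))

  DeparturesIncrease : ℕ → Set
  DeparturesIncrease v = ∀ {k k′} → Consecutive (Departs v) 0 N k k′ → d k ℤ.< d k′

  DeparturesIncreaseButLast : ℕ → Set
  DeparturesIncreaseButLast v =
    ∀ {k k′} → Consecutive (Departs v) 0 N k k′ → HasLater (Departs v) 0 N k′ → d k ℤ.< d k′

  AllDeparturesIncrease : Set
  AllDeparturesIncrease = DeparturesIncrease n × (∀ {v} → 1 ≤ v → v < n → DeparturesIncreaseButLast v)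

  StrictInc-nb⇔ : StrictInc (nb n a b n) ⇔ DeparturesIncrease n
  StrictInc-nb⇔ = mk⇔ to from
    where
    open Consecutive
    to : StrictInc (nb n a b n) → DeparturesIncrease n
    to inc c = Equivalence.to (∣d∣<⇔d< (proj₂ (left∈ c)) (proj₂ (right∈ c)))
      (subst₂ _<_ (target-n (proj₂ (left∈ c)) (P-left c)) (target-n (proj₂ (right∈ c)) (P-right c))
        (Linked-filterRange⁻ (departs? n) 0 N (Linked.map⁻ (subst StrictInc (nb≡ n) inc)) c))
    from : DeparturesIncrease n → StrictInc (nb n a b n)
    from inc = subst StrictInc (sym (nb≡ n)) (Linked.map⁺ (Linked-filterRange⁺ (departs? n) 0 N (λ c →
      subst₂ _<_ (sym (target-n (proj₂ (left∈ c)) (P-left c))) (sym (target-n (proj₂ (right∈ c)) (P-right c)))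
        (Equivalence.from (∣d∣<⇔d< (proj₂ (left∈ c)) (proj₂ (right∈ c))) (inc c)))))

  target≢ : ∀ {v k} → k < N → Departs v k → target k ≢ v
  target≢ {v} k<N dep target≡v =
    ℕ.<⇒≢ (proj₁ (0<∣d∣<n k<N)) (trans (sym (offset-self v)) (trans (cong (offset v) (sym target≡v)) (offset-target k<N dep)))

  nb-nonempty : ∀ {v} → 1 ≤ v → v < n → 1 ≤ length (nb n a b v)
  nb-nonempty {v} 1≤v v<n = subst (1 ≤_) (sym (trans (cong length (nb≡ v)) (length-map target (filterRange (departs? v) 0 N))))
    (∈⇒1≤length (filterRange-∈ (departs? v) 0 N (z≤n , g<N) (p≈⇒Departs g<N p-g≈c)))
    where
    open TokenSteps (tokenSteps (1≤v , subst (v <_) (sym 1+[n-1]≡n) v<n))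
    ∈⇒1≤length : ∀ {x} {xs : List ℕ} → x ∈ xs → 1 ≤ length xs
    ∈⇒1≤length (here _)  = s≤s z≤n
    ∈⇒1≤length (there _) = s≤s z≤n

  module _ {v} (1≤v : 1 ≤ v) (v<n : v < n) where
    open Consecutive

    private
      fl : List ℕ
      fl = filterRange (departs? v) 0 N

      dropLast-nb≡ : dropLast (nb n a b v) ≡ map target (dropLast fl)
      dropLast-nb≡ = trans (cong dropLast (nb≡ v)) (dropLast-map target fl)

    CycCond-nb⇔ : CycCond v (nb n a b v) ⇔ DeparturesIncreaseButLast v
    CycCond-nb⇔ = mk⇔ to from
      where
      to : CycCond v (nb n a b v) → DeparturesIncreaseButLast v
      to cyc {k} {k′} c later = Equivalence.to (∣d∣<⇔d< k<N k′<N)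
        (subst₂ _<_ (offset-target k<N (P-left c)) (offset-target k′<N (P-right c))
          (≺⇒offset< 1≤v v<n (res≤n (b (suc k))) (1≤res (b (suc k′))) (res≤n (b (suc k′)))
            (Linked-dropLast-filterRange⁻ (departs? v) 0 N
              (Linked.map⁻ (subst (Linked _≺⟨ v ⟩_) dropLast-nb≡ (CycCond⇒Linked-≺ v (nb n a b v) cyc))) c later)))
        where
        k<N = proj₂ (left∈ c)
        k′<N = proj₂ (right∈ c)
      from : DeparturesIncreaseButLast v → CycCond v (nb n a b v)
      from inc = Linked-≺⇒CycCond v (nb n a b v) (nb-nonempty 1≤v v<n) ≢v
        (subst (Linked _≺⟨ v ⟩_) (sym dropLast-nb≡) (Linked.map⁺ (Linked-dropLast-filterRange⁺ (departs? v) 0 N ≺-step)))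
        where
        ≢v : All (_≢ v) (dropLast (nb n a b v))
        ≢v = subst (All (_≢ v)) (sym dropLast-nb≡)
          (All.map⁺ (All.take⁺ _ (All.map (λ ((_ , k<N) , dep) → target≢ k<N dep) (filterRange-all (departs? v) 0 N))))
        ≺-step : ∀ {k k′} → Consecutive (Departs v) 0 N k k′ → HasLater (Departs v) 0 N k′ → target k ≺⟨ v ⟩ target k′
        ≺-step {k} {k′} c later = offset<⇒≺ 1≤v v<n (target≢ k<N (P-left c)) (target≢ k′<N (P-right c))
          (res≤n (b (suc k))) (res≤n (b (suc k′)))
          (subst₂ _<_ (sym (offset-target k<N (P-left c))) (sym (offset-target k′<N (P-right c)))
            (Equivalence.from (∣d∣<⇔d< k<N k′<N) (inc c later)))
          where
          k<N = proj₂ (left∈ c)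
          k′<N = proj₂ (right∈ c)

  Cyclic⇔AllDeparturesIncrease : Cyclic n a b ⇔ AllDeparturesIncrease
  Cyclic⇔AllDeparturesIncrease = mk⇔
    (λ (inc , cyc) → Equivalence.to StrictInc-nb⇔ inc , λ 1≤v v<n → Equivalence.to (CycCond-nb⇔ 1≤v v<n) (cyc _ 1≤v v<n))
    (λ (inc , inc′) → Equivalence.from StrictInc-nb⇔ inc , λ _ 1≤v v<n → Equivalence.from (CycCond-nb⇔ 1≤v v<n) (inc′ 1≤v v<n))

  IncreasingAtReturns⇒departures-increase : IncreasingAtReturns → ∀ {v k k′} → Consecutive (Departs v) 0 N k k′ →
                                            v ≡ n ⊎ HasLater (Departs v) 0 N k′ → d k ℤ.< d k′
  IncreasingAtReturns⇒departures-increase returns {v} {k} {suc j} c last⊎later =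
    [ arrives-first , ⊥-elim ∘ not-second ]′ (step-first⊎second j+1<N)
    where
    open Consecutive c
    j+1<N : suc j < N
    j+1<N = proj₂ right∈
    j<N : j < N
    j<N = ℕ.<-trans (ℕ.n<1+n j) j+1<N
    k≤j : k ≤ j
    k≤j = ℕ.≤-pred left<right
    p-k≈v : p k ≈ + v
    p-k≈v = Departs⇒p≈ (proj₂ left∈) P-left
    p-j+1≈v : p (suc j) ≈ + v
    p-j+1≈v = Departs⇒p≈ j+1<N P-right
    t = stepSteps j<N
    t′ = stepSteps j+1<N
    open TokenSteps t using (f; g; f<g; f<N; p-suc-f≈c; p-suc-g≈p-f; p≉c-before; p≉p-f-between)
    open TokenSteps t′ using () renaming (f to f′; g to g′; p-g≈c to p-g′≈c′; p≉c-after to p≉c′-after)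

    not-second : suc j ≡ g′ → ⊥
    not-second j+1≡g′ = [ last , later ]′ last⊎later
      where
      p-j+1≈c′ : p (suc j) ≈ + token (suc (suc j))
      p-j+1≈c′ = subst (λ i → p i ≈ + token (suc (suc j))) (sym j+1≡g′) p-g′≈c′
      c′≈v : + token (suc (suc j)) ≈ + v
      c′≈v = ≈-trans (≈-sym p-j+1≈c′) p-j+1≈v
      last : v ≡ n → ⊥
      last v≡n = Token⇒≉p0 (token∈ j+1<N) (≈-trans c′≈v (subst (λ w → + w ≈ p 0) (sym v≡n) (≈-trans n≈0 (≈-sym p0≈0))))
      later : HasLater (Departs v) 0 N (suc j) → ⊥
      later (k″ , (_ , k″<N) , j+1<k″ , dep) =
        p≉c′-after k″ (subst (_< k″) j+1≡g′ j+1<k″) (ℕ.<⇒≤ k″<N) (≈-trans (Departs⇒p≈ k″<N dep) (≈-sym c′≈v))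

    arrives-first : suc j ≡ f′ → d k ℤ.< d (suc j)
    arrives-first j+1≡f′ = [ ⊥-elim ∘ previous-first , previous-second ]′ (step-first⊎second j<N)
      where
      previous-first : j ≡ f → ⊥
      previous-first j≡f = p≉c-before k (subst (k ≤_) j≡f k≤j)
        (≈-trans p-k≈v (≈-trans (≈-sym p-j+1≈v) (subst (λ i → p (suc i) ≈ + token (suc j)) (sym j≡f) p-suc-f≈c)))
      previous-second : j ≡ g → d k ℤ.< d (suc j)
      previous-second j≡g = subst (λ i → d i ℤ.< d (suc j)) (sym k≡f) (returns t t′ j≡g j+1≡f′)
        where
        p-f≈v : p f ≈ + v
        p-f≈v = ≈-trans (≈-sym (subst (λ i → p (suc i) ≈ p f) (sym j≡g) p-suc-g≈p-f)) p-j+1≈v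
        k≡f : k ≡ f
        k≡f = ℕ.≤-antisym
          (ℕ.≮⇒≥ (λ f<k → p≉p-f-between k f<k (subst (k ≤_) j≡g k≤j) (≈-trans p-k≈v (≈-sym p-f≈v))))
          (ℕ.≮⇒≥ (λ k<f → gap f k<f (subst (f <_) (cong suc (sym j≡g)) (ℕ.m<n⇒m<1+n f<g)) (p≈⇒Departs f<N p-f≈v)))

  IncreasingAtReturns⇒AllDeparturesIncrease : IncreasingAtReturns → AllDeparturesIncrease
  IncreasingAtReturns⇒AllDeparturesIncrease returns =
      (λ c → IncreasingAtReturns⇒departures-increase returns c (inj₁ refl))
    , (λ _ _ c later → IncreasingAtReturns⇒departures-increase returns c (inj₂ later))

  AllDeparturesIncrease⇒IncreasingAtReturns : AllDeparturesIncrease → IncreasingAtReturns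
  AllDeparturesIncrease⇒IncreasingAtReturns (inc-n , inc) {k} {c′ = c′} t t′ k≡g k+1≡f′ =
    [ (λ v<n → inc (1≤res (p (suc k))) v<n consecutive-f (later v<n))
    , (λ v≡n → inc-n (subst (λ w → Consecutive (Departs w) 0 N f (suc k)) v≡n consecutive-f))
    ]′ (ℕ.m≤n⇒m<n∨m≡n (res≤n (p (suc k))))
    where
    open TokenSteps t using (f; g; f<g; f<N; p-suc-g≈p-f; p≉p-f-between)
    open TokenSteps t′ using () renaming (f to f′; g to g′; f<g to f′<g′; f<N to f′<N; token-f to token-f′; only to only′)
    v : ℕ
    v = res n (p (suc k))
    p-k+1≈v : p (suc k) ≈ + v
    p-k+1≈v = ≈-sym (res≈ (p (suc k)))
    k+1<N : suc k < N
    k+1<N = subst (_< N) (sym k+1≡f′) f′<N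
    p-f≈v : p f ≈ + v
    p-f≈v = ≈-trans (≈-sym (subst (λ i → p (suc i) ≈ p f) (sym k≡g) p-suc-g≈p-f)) p-k+1≈v

    consecutive-f : Consecutive (Departs v) 0 N f (suc k)
    consecutive-f = consecutive (z≤n , f<N) (z≤n , k+1<N) (subst (f <_) (cong suc (sym k≡g)) (ℕ.m<n⇒m<1+n f<g))
      (p≈⇒Departs f<N p-f≈v) (p≈⇒Departs k+1<N p-k+1≈v) gap
      where
      gap : ∀ i → f < i → i < suc k → ¬ Departs v i
      gap i f<i i<k+1 dep = p≉p-f-between i f<i (subst (i ≤_) k≡g (ℕ.≤-pred i<k+1))
        (≈-trans (Departs⇒p≈ (ℕ.<-trans i<k+1 k+1<N) dep) (≈-sym p-f≈v))

    later : v < n → HasLater (Departs v) 0 N (suc k)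
    later v<n = by-cmp (ℕ.<-cmp (suc k) g-v)
      where
      open TokenSteps (tokenSteps (1≤res (p (suc k)) , subst (v <_) (sym 1+[n-1]≡n) v<n))
        using () renaming (f to f-v; g to g-v; f<g to f-v<g-v; f<N to f-v<N; g<N to g-v<N;
                           token-f to token-f-v; token-g to token-g-v; p-g≈c to p-g-v≈v; p≉c-after to p≉v-after)
      by-cmp : Tri (suc k < g-v) (suc k ≡ g-v) (g-v < suc k) → HasLater (Departs v) 0 N (suc k)
      by-cmp (tri< k+1<g-v _ _) = g-v , (z≤n , g-v<N) , k+1<g-v , p≈⇒Departs g-v<N p-g-v≈v
      by-cmp (tri> _ _ g-v<k+1) = ⊥-elim (p≉v-after (suc k) g-v<k+1 (ℕ.<⇒≤ k+1<N) p-k+1≈v)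
      by-cmp (tri≈ _ k+1≡g-v _) = ⊥-elim ([ f-v≢f′ , f-v≢g′ ]′ (only′ f-v f-v<N (trans token-f-v (sym c′≡v))))
        where
        f′≡g-v : f′ ≡ g-v
        f′≡g-v = trans (sym k+1≡f′) k+1≡g-v
        c′≡v : c′ ≡ v
        c′≡v = trans (sym token-f′) (trans (cong (token ∘ suc) f′≡g-v) token-g-v)
        f-v≢f′ : f-v ≢ f′
        f-v≢f′ f-v≡f′ = ℕ.<-irrefl (trans f-v≡f′ f′≡g-v) f-v<g-v
        f-v≢g′ : f-v ≢ g′
        f-v≢g′ f-v≡g′ = ℕ.<-asym f′<g′ (subst (_< f′) f-v≡g′ (subst (f-v <_) (sym f′≡g-v) f-v<g-v))

  Cyclic⇔Increasing : Cyclic n a b ⇔ Increasing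
  Cyclic⇔Increasing = ⇔-trans Cyclic⇔AllDeparturesIncrease (⇔-trans
    (mk⇔ AllDeparturesIncrease⇒IncreasingAtReturns IncreasingAtReturns⇒AllDeparturesIncrease)
    (mk⇔ IncreasingAtReturns⇒Increasing Increasing⇒IncreasingAtReturns))

proposition4p4 : (n : ℕ) .{{_ : NonZero n}} → 2 ℕ.≤ n → (a b : ℕ → ℤ) → TreeLike n a b →
    ∃ λ (m : ℕ → ℤ) →
      (∀ j → 1 ℕ.≤ j → j ℕ.≤ 2 ℕ.* n ∸ 2 →
        ¬ ((+ 0) ≡[ n ] m j)
        × (∀ x → (lprod (reflSeq n a b) (j ∸ 1) ∘ reflSeq n a b j ∘ rprod (reflSeq n a b) (j ∸ 1)) x
                 ≡ refl⟨ n ⟩ (+ 0) (m j) x))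
      × (Cyclic n a b ⇔ (∀ j → 1 ℕ.≤ j → j ℕ.< 2 ℕ.* n ∸ 2 → m j ℤ.< m (ℕ.suc j)))
proposition4p4 n 2≤n a b T = m , conjugates , Cyclic⇔Increasing
  where
  open Factorization n 2≤n a b T
  conjugates : ∀ j → 1 ≤ j → j ≤ N →
               ¬ ((+ 0) ≡[ n ] m j) × (∀ x → (L (j ∸ 1) ∘ r j ∘ F (j ∸ 1)) x ≡ refl⟨ n ⟩ (+ 0) (m j) x)
  conjugates (suc k) _ k<N = m≉0 k k<N , conjugate k k<N
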